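{- Let $m\ge1$, let $k_1,\ldots,k_m\ge 2$ be integers with $k_1+\cdots+k_m=n$, and let $G=D_n(k_1,\ldots,k_m)$ with vertex set $X\cup Y\cup Z$ as in its definition. Then $G$ is vertex decomposable and $\mathrm{Shed}(G)=Z$.
   Context: $D_n(k_1,\ldots,k_m)$ is the graph on the $5n$ vertices $X\cup Y\cup Z$ with $X=\{x_1,\ldots,x_{2n}\}$, $Y=\{y_1,\ldots,y_{2n}\}$, $Z=\{z_1,\ldots,z_n\}$, whose edges are exactly: (i) all pairs in $Z$ (so $Z$ induces $K_n$); (ii) no edges within $Y$; (iii) the induced graph on $X$ is a disjoint union $K_{k_1,k_1}\sqcup\cdots\sqcup K_{k_m,k_m}$ where, with $w=\sum_{\ell=1}^{i-1}k_\ell$ ($w=0$ for $i=1$), the $i$-th complete bipartite graph has bipartition $\{x_{2w+1},x_{2w+3},\ldots,x_{2(w+k_i)-1}\}\cup\{x_{2w+2},x_{2w+4},\ldots,x_{2(w+k_i)}\}$; (iv) $\{x_j,y_j\}$ for $1\le j\le 2n$; (v) $\{z_j,y_{2j}\}$ and $\{z_j,y_{2j-1}\}$ for $1\le j\le n$. For a graph $G=(V,E)$ and $x\in V$, $G\setminus x$ is the graph obtained by deleting $x$ and its incident edges; $N[x]$ is $x$ together with its neighbours, and $G\setminus N[x]$ is obtained by deleting all vertices of $N[x]$ and their incident edges. A graph is well-covered if all its maximal independent sets have the same cardinality. A graph $G$ is vertex decomposable if $G$ is well-covered and either (i) $G$ has no edges (possibly no vertices), or (ii) there is a vertex $x$ such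 that both $G\setminus x$ and $G\setminus N[x]$ are vertex decomposable. For a vertex decomposable graph $G$, $\mathrm{Shed}(G)$ is the set of vertices $x$ such that $G\setminus x$ and $G\setminus N[x]$ are both vertex decomposable. -}

module Defs where

open import Data.Nat using (ℕ; zero; suc; _+_; _*_; _∸_; _≤_; _<ᵇ_; _≡ᵇ_; _%_)
open import Data.Bool using (Bool; true; false; _∧_; _∨_; not; if_then_else_)
open import Data.List using (List; []; _∷_)
open import Data.Fin using (Fin; toℕ)
open import Data.Fin.Subset using (Subset; _∈_; _∉_; _⊆_; ∣_∣)
open import Data.Vec using (lookup; tabulate)
open import Data.Product using (Σ; _×_; ∃)
open import Relation.Nullary using (¬_)
open import Relation.Binary.PropositionalEquality using (_≡_)

-- A (sub)graph under consideration is the subgraph of E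
-- induced on a vertex subset S : Subset N.  G \ x and G \ N[x] are
-- again induced subgraphs, on smaller subsets.

Adj : ℕ → Set
Adj N = Fin N → Fin N → Bool

module _ {N : ℕ} (E : Adj N) where

  Independent : Subset N → Subset N → Set
  Independent S I = I ⊆ S × (∀ u v → u ∈ I → v ∈ I → E u v ≡ false)

  MaximalIndependent : Subset N → Subset N → Set
  MaximalIndependent S I =
    Independent S I × (∀ J → Independent S J → I ⊆ J → J ⊆ I)

  WellCovered : Subset N → Set
  WellCovered S = ∀ I J → MaximalIndependent S I → MaximalIndependent S J
                  → ∣ I ∣ ≡ ∣ J ∣

  NoEdges : Subset N → Set
  NoEdges S = ∀ u v → u ∈ S → v ∈ S → E u v ≡ false

  delete : Subset N → Fin N → Subset N
  delete S x = tabulate λ v → lookup S v ∧ not (toℕ v ≡ᵇ toℕ x)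

  deleteClosedNbhd : Subset N → Fin N → Subset N
  deleteClosedNbhd S x =
    tabulate λ v → lookup S v ∧ not (toℕ v ≡ᵇ toℕ x) ∧ not (E x v)

  -- vertex decomposability (as defined in the paper, including the
  -- well-coveredness requirement)
  data VertexDecomposable (S : Subset N) : Set where
    vd-empty : WellCovered S → NoEdges S → VertexDecomposable S
    vd-shed  : WellCovered S → (x : Fin N) → x ∈ S
             → VertexDecomposable (delete S x)
             → VertexDecomposable (deleteClosedNbhd S x)
             → VertexDecomposable S

  Shed : Subset N → Fin N → Set
  Shed S x = x ∈ S × VertexDecomposable (delete S x)
                   × VertexDecomposable (deleteClosedNbhd S x)

-- The graph D_n(k_1,...,k_m), on 5n vertices indexed 0..5n-1:
--   x_j (1 ≤ j ≤ 2n)  ↦ index j - 1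
--   y_j (1 ≤ j ≤ 2n)  ↦ index 2n + j - 1
--   z_j (1 ≤ j ≤ n)   ↦ index 4n + j - 1

-- blockOf ks p : index (0-based) of the complete bipartite block
-- K_{k_i,k_i} containing x_{p+1}: block i occupies 0-based positions
-- 2w, ..., 2(w+k_i) - 1 with w = k_1 + ... + k_{i-1}.
blockOf : List ℕ → ℕ → ℕ
blockOf []       p = 0
blockOf (k ∷ ks) p = if p <ᵇ (2 * k) then 0 else suc (blockOf ks (p ∸ (2 * k)))

infix 4 _≤ᵇ'_
_≤ᵇ'_ : ℕ → ℕ → Bool
a ≤ᵇ' b = a <ᵇ suc b

arcD : ℕ → List ℕ → ℕ → ℕ → Bool
arcD n ks p q =
  ((4 * n ≤ᵇ' p) ∧ (4 * n ≤ᵇ' q) ∧ not (p ≡ᵇ q))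
  -- (iii) X-edges: same block, opposite parity (within a block the odd
  -- x's x_{2w+1}, x_{2w+3}, ... are the even 0-based positions)
  ∨ ((p <ᵇ (2 * n)) ∧ (q <ᵇ (2 * n)) ∧ (blockOf ks p ≡ᵇ blockOf ks q)
       ∧ not ((p % 2) ≡ᵇ (q % 2)))
  ∨ ((p <ᵇ (2 * n)) ∧ (q ≡ᵇ (2 * n + p)))
  -- (v) z_j -- y_{2j-1}, y_{2j}   (0-based: z_t -- y_{2t}, y_{2t+1})
  ∨ ((4 * n ≤ᵇ' p) ∧ (p <ᵇ (5 * n)) ∧ (q ≡ᵇ (2 * n + 2 * (p ∸ 4 * n))))
  ∨ ((4 * n ≤ᵇ' p) ∧ (p <ᵇ (5 * n)) ∧ (q ≡ᵇ (2 * n + 2 * (p ∸ 4 * n) + 1)))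

D : (n : ℕ) → List ℕ → Adj (5 * n)
D n ks u v = arcD n ks (toℕ u) (toℕ v) ∨ arcD n ks (toℕ v) (toℕ u)

allV : (N : ℕ) → Subset N
allV N = tabulate λ _ → true

InZ : {n : ℕ} → Fin (5 * n) → Set
InZ {n} v = 4 * n ≤ toℕ v

-- Group the vertices of G = D_n(k_1,...,k_m) into the n gadgets
-- {x_{2t-1}, x_{2t}, y_{2t-1}, y_{2t}, z_t}. A maximal independent set of G
-- meets every gadget in exactly two vertices, so G is well-covered. Shedding a
-- z keeps all x's and y's, so the same count applies to G \ z; in G \ N[z]
-- and in everything reached from it by shedding x's, the number of vertices a
-- maximal independent set takes from a gadget is still determined by which
-- vertices of the gadget are present, so these graphs stay well-covered, and
-- shedding x's ends in edgeless graphs. Conversely, deleting an x or a y leaves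
-- maximal independent sets of sizes 2n and 2n - 1: for x_j one uses a second
-- x of the same side of its block, which exists as k_i ≥ 2, and for y_j a
-- second gadget, which exists as n ≥ 2.

module Submission where

open import Data.Bool using (Bool; true; false; _∧_; _∨_; _xor_; not; T)
open import Data.Bool.Properties
  using (T-≡; ∨-identityʳ; ∨-zeroʳ; ∨-comm; ∨-idem; ∧-zeroʳ; not-involutive; ¬-not; not-¬; xor-same; xor-comm)
  renaming (_≟_ to _≟ᴮ_)
open import Data.Empty using (⊥; ⊥-elim)
open import Data.Fin using (Fin; toℕ; fromℕ<)
open import Data.Fin.Properties using (toℕ-fromℕ<; toℕ<n; any?)
open import Data.Fin.Subset using (Subset; _∈_; _∉_; _⊆_; ∣_∣; _∪_; ⁅_⁆)
open import Data.Fin.Subset.Properties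
  using (_∈?_; p⊆q⇒∣p∣≤∣q∣; p⊂q⇒∣p∣<∣q∣; x∈⁅x⁆; x∈⁅y⁆⇒x≡y; p⊆p∪q; q⊆p∪q; x∈p∪q⁻)
open import Data.List using (List; []; _∷_; length)
open import Data.List.Relation.Unary.All using (All; []; _∷_)
open import Data.Nat
open import Data.Nat.DivMod using (_%_; [m+n]%n≡m%n)
open import Data.Nat.ListAction using (sum)
open import Data.Nat.Properties
open import Data.Nat.Solver using (module +-*-Solver)
open import Data.Product using (∃; _×_; _,_; proj₁; proj₂)
open import Data.Sum using (_⊎_; inj₁; inj₂; [_,_]′)
open import Data.Vec using (Vec; []; _∷_; lookup; tabulate)
open import Data.Vec.Properties using (lookup∘tabulate; []=⇒lookup; lookup⇒[]=)
open import Function.Bundles using (Equivalence)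
open import Relation.Binary.PropositionalEquality
  using (_≡_; _≢_; refl; sym; trans; cong; cong₂; subst; subst₂; module ≡-Reasoning)
open import Relation.Nullary using (¬_; Dec; yes; no)
open import Relation.Nullary.Decidable using (_×-dec_)
open import Defs

open +-*-Solver using (solve; _:+_; _:=_)

bit : Bool → ℕ
bit true  = 1
bit false = 0

true≢false : ∀ {a} → a ≡ true → a ≡ false → ⊥
true≢false refl ()

≢true⇒≡false : ∀ {a} → ¬ a ≡ true → a ≡ false
≢true⇒≡false = ¬-not

≢false⇒≡true : ∀ {a} → ¬ a ≡ false → a ≡ true
≢false⇒≡true = ¬-not

not-false⁻ : ∀ {a} → not a ≡ false → a ≡ true
not-false⁻ {true} _ = refl

not-true⁻ : ∀ {a} → not a ≡ true → a ≡ false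
not-true⁻ {false} _ = refl

∧-false⁻ : ∀ {a b} → a ≡ true → (a ∧ b) ≡ false → b ≡ false
∧-false⁻ refl b≡false = b≡false

∧-true⁻ˡ : ∀ {a b} → (a ∧ b) ≡ true → a ≡ true
∧-true⁻ˡ {true} _ = refl

∧-true⁻ʳ : ∀ {a b} → (a ∧ b) ≡ true → b ≡ true
∧-true⁻ʳ {true} e = e

bit+bit≡1 : ∀ a b → (a ≡ true → b ≡ true → ⊥) → (a ≡ false → b ≡ false → ⊥) → bit a + bit b ≡ 1
bit+bit≡1 true  true  both    _       = ⊥-elim (both refl refl)
bit+bit≡1 true  false _       _       = refl
bit+bit≡1 false true  _       _       = refl
bit+bit≡1 false false _       neither = ⊥-elim (neither refl refl)

-- Read a, b as the memberships in S of two adjacent vertices, x, y as their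
-- memberships in a maximal independent set of S.
bit+bit≡bit-∨ : ∀ a b x y → (x ≡ true → a ≡ true) → (y ≡ true → b ≡ true) → (x ≡ true → y ≡ true → ⊥)
              → (b ≡ true → y ≡ false → x ≡ true) → (a ≡ true → b ≡ false → x ≡ true)
              → bit x + bit y ≡ bit (a ∨ b)
bit+bit≡bit-∨ a     b     true  true  _    _    both _     _     = ⊥-elim (both refl refl)
bit+bit≡bit-∨ a     b     true  false x⊆a  _    _    _     _     rewrite x⊆a refl = refl
bit+bit≡bit-∨ a     b     false true  _    y⊆b  _    _     _     rewrite y⊆b refl = cong bit (sym (∨-zeroʳ a))
bit+bit≡bit-∨ a     true  false false _    _    _    y-dom _     = ⊥-elim (true≢false (y-dom refl refl) refl)
bit+bit≡bit-∨ true  false false false _    _    _    _     x-dom = ⊥-elim (true≢false (x-dom refl refl) refl)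
bit+bit≡bit-∨ false false false false _    _    _    _     _     = refl

xor-false⁻ : ∀ {c b} → c xor b ≡ false → c ≡ b
xor-false⁻ {true}  {true}  _ = refl
xor-false⁻ {false} {false} _ = refl

xor-not : ∀ b → b xor not b ≡ true
xor-not true  = refl
xor-not false = refl

not-xor : ∀ b → not b xor b ≡ true
not-xor true  = refl
not-xor false = refl

xor-true⁻ : ∀ {c b} → c xor b ≡ true → c ≡ not b
xor-true⁻ {true}  {false} _ = refl
xor-true⁻ {false} {true}  _ = refl

not-xor-true⁻ : ∀ {c b} → not (c xor b) ≡ true → c ≡ b
not-xor-true⁻ {true}  {true}  _ = refl
not-xor-true⁻ {false} {false} _ = refl

T⇒≡true : ∀ {a} → T a → a ≡ true
T⇒≡true = Equivalence.to T-≡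

<ᵇ-true : ∀ {a b} → a < b → (a <ᵇ b) ≡ true
<ᵇ-true h = T⇒≡true (<⇒<ᵇ h)

<ᵇ-false : ∀ {a b} → b ≤ a → (a <ᵇ b) ≡ false
<ᵇ-false {a} {b} h = ≢true⇒≡false λ e → <⇒≱ (<ᵇ⇒< a b (subst T (sym e) _)) h

≤ᵇ'-true : ∀ {a b} → a ≤ b → (a ≤ᵇ' b) ≡ true
≤ᵇ'-true h = <ᵇ-true (s≤s h)

≤ᵇ'-false : ∀ {a b} → b < a → (a ≤ᵇ' b) ≡ false
≤ᵇ'-false = <ᵇ-false

≡ᵇ-refl : ∀ a → (a ≡ᵇ a) ≡ true
≡ᵇ-refl a = T⇒≡true (≡⇒≡ᵇ a a refl)

≡ᵇ-false : ∀ {a b} → a ≢ b → (a ≡ᵇ b) ≡ false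
≡ᵇ-false {a} {b} h = ≢true⇒≡false λ e → h (≡ᵇ⇒≡ a b (subst T (sym e) _))

≡ᵇ-true⁻ : ∀ {a b} → (a ≡ᵇ b) ≡ true → a ≡ b
≡ᵇ-true⁻ {a} {b} e = ≡ᵇ⇒≡ a b (subst T (sym e) _)

≡ᵇ-sym : ∀ a b → (a ≡ᵇ b) ≡ (b ≡ᵇ a)
≡ᵇ-sym zero    zero    = refl
≡ᵇ-sym zero    (suc b) = refl
≡ᵇ-sym (suc a) zero    = refl
≡ᵇ-sym (suc a) (suc b) = ≡ᵇ-sym a b

+-≡ᵇ-cancelˡ : ∀ a b c → ((a + b) ≡ᵇ (a + c)) ≡ (b ≡ᵇ c)
+-≡ᵇ-cancelˡ zero    b c = refl
+-≡ᵇ-cancelˡ (suc a) b c = +-≡ᵇ-cancelˡ a b c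

findBelow : ∀ m (p : ℕ → Bool) → (∃ λ t → t < m × p t ≡ true) ⊎ (∀ t → t < m → p t ≡ false)
findBelow m p with anyUpTo? (λ t → p t ≟ᴮ true) m
... | yes found = inj₁ found
... | no  none  = inj₂ λ t t<m → ≢true⇒≡false λ e → none (t , t<m , e)

-- Positions past the end read as false, so no bound proofs are needed to
-- state membership of computed positions.
infixl 9 _!_
_!_ : ∀ {m} → Vec Bool m → ℕ → Bool
[]      ! _     = false
(b ∷ v) ! zero  = b
(b ∷ v) ! suc i = v ! i

!-toℕ : ∀ {m} (v : Vec Bool m) (i : Fin m) → v ! toℕ i ≡ lookup v i
!-toℕ (b ∷ v) Fin.zero    = refl
!-toℕ (b ∷ v) (Fin.suc i) = !-toℕ v i

!-≥ : ∀ {m} (v : Vec Bool m) i → m ≤ i → v ! i ≡ false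
!-≥ []      i       _       = refl
!-≥ (b ∷ v) (suc i) (s≤s h) = !-≥ v i h

!-fromℕ< : ∀ {m} (v : Vec Bool m) {i} (h : i < m) → v ! toℕ (fromℕ< h) ≡ v ! i
!-fromℕ< v h = cong (v !_) (toℕ-fromℕ< h)

!-tabulate : ∀ {m} (f : Fin m → Bool) {i} (h : i < m) → tabulate f ! i ≡ f (fromℕ< h)
!-tabulate f h = trans (sym (!-fromℕ< (tabulate f) h)) (trans (!-toℕ (tabulate f) (fromℕ< h)) (lookup∘tabulate f (fromℕ< h)))

∈⇒! : ∀ {m} {p : Subset m} {i : Fin m} → i ∈ p → p ! toℕ i ≡ true
∈⇒! {p = p} {i} h = trans (!-toℕ p i) ([]=⇒lookup h)

!⇒∈ : ∀ {m} {p : Subset m} {i : Fin m} → p ! toℕ i ≡ true → i ∈ p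
!⇒∈ {p = p} {i} h = lookup⇒[]= i p (trans (sym (!-toℕ p i)) h)

!-true⇒< : ∀ {m} (v : Vec Bool m) i → v ! i ≡ true → i < m
!-true⇒< {m} v i h with i <? m
... | yes i<m = i<m
... | no  i≮m = ⊥-elim (true≢false h (!-≥ v i (≮⇒≥ i≮m)))

!-restrict : ∀ {m} (S : Subset m) (g : ℕ → Bool) i → tabulate (λ v → lookup S v ∧ g (toℕ v)) ! i ≡ (S ! i ∧ g i)
!-restrict {m} S g i with i <? m
... | yes i<m = begin
  tabulate (λ v → lookup S v ∧ g (toℕ v)) ! i     ≡⟨ !-tabulate (λ v → lookup S v ∧ g (toℕ v)) i<m ⟩
  lookup S (fromℕ< i<m) ∧ g (toℕ (fromℕ< i<m))    ≡⟨ cong (_∧ g (toℕ (fromℕ< i<m))) (!-toℕ S (fromℕ< i<m)) ⟨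
  S ! toℕ (fromℕ< i<m) ∧ g (toℕ (fromℕ< i<m))     ≡⟨ cong (λ j → S ! j ∧ g j) (toℕ-fromℕ< i<m) ⟩
  S ! i ∧ g i                                     ∎
  where open ≡-Reasoning
... | no i≮m = trans (!-≥ (tabulate (λ v → lookup S v ∧ g (toℕ v))) i (≮⇒≥ i≮m)) (cong (_∧ g i) (sym (!-≥ S i (≮⇒≥ i≮m))))

sumBelow : ℕ → (ℕ → ℕ) → ℕ
sumBelow zero    f = 0
sumBelow (suc m) f = f 0 + sumBelow m (λ i → f (suc i))

∣_∣-sumBelow : ∀ {m} (v : Vec Bool m) → ∣ v ∣ ≡ sumBelow m (λ i → bit (v ! i))
∣ []        ∣-sumBelow = refl
∣ true  ∷ v ∣-sumBelow = cong suc ∣ v ∣-sumBelow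
∣ false ∷ v ∣-sumBelow = ∣ v ∣-sumBelow

sumBelow-cong : ∀ m {f g} → (∀ i → i < m → f i ≡ g i) → sumBelow m f ≡ sumBelow m g
sumBelow-cong zero    h = refl
sumBelow-cong (suc m) h = cong₂ _+_ (h 0 z<s) (sumBelow-cong m (λ i p → h (suc i) (s<s p)))

sumBelow-mono-< : ∀ m {f g} → (∀ i → i < m → f i ≤ g i) → ∀ j → j < m → f j < g j → sumBelow m f < sumBelow m g
sumBelow-mono-< (suc m) h zero    _         lt =
  +-mono-<-≤ lt (sumBelow-mono-≤ m (λ i p → h (suc i) (s<s p)))
  where
  sumBelow-mono-≤ : ∀ m {f g} → (∀ i → i < m → f i ≤ g i) → sumBelow m f ≤ sumBelow m g
  sumBelow-mono-≤ zero    h = z≤n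
  sumBelow-mono-≤ (suc m) h = +-mono-≤ (h 0 z<s) (sumBelow-mono-≤ m (λ i p → h (suc i) (s<s p)))
sumBelow-mono-< (suc m) h (suc j) (s<s jm) lt =
  +-mono-≤-< (h 0 z<s) (sumBelow-mono-< m (λ i p → h (suc i) (s<s p)) j jm lt)

sumBelow-+ : ∀ a b f → sumBelow (a + b) f ≡ sumBelow a f + sumBelow b (λ i → f (a + i))
sumBelow-+ zero    b f = refl
sumBelow-+ (suc a) b f = trans (cong (f 0 +_) (sumBelow-+ a b (λ i → f (suc i)))) (sym (+-assoc (f 0) _ _))

sumBelow-distrib : ∀ m f g → sumBelow m (λ i → f i + g i) ≡ sumBelow m f + sumBelow m g
sumBelow-distrib zero    f g = refl
sumBelow-distrib (suc m) f g =
  trans (cong (f 0 + g 0 +_) (sumBelow-distrib m (λ i → f (suc i)) (λ i → g (suc i)))) (interchange (f 0) (g 0) _ _)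
  where
  interchange : ∀ a b c d → a + b + (c + d) ≡ a + c + (b + d)
  interchange = solve 4 (λ a b c d → a :+ b :+ (c :+ d) := a :+ c :+ (b :+ d)) refl

sumBelow-const : ∀ m {f} c → (∀ i → i < m → f i ≡ c) → sumBelow m f ≡ m * c
sumBelow-const zero    c h = refl
sumBelow-const (suc m) c h = cong₂ _+_ (h 0 z<s) (sumBelow-const m c (λ i p → h (suc i) (s<s p)))

module _ {N : ℕ} (E : Adj N) where

  lookup-delete : ∀ S x v → lookup (delete E S x) v ≡ (lookup S v ∧ not (toℕ v ≡ᵇ toℕ x))
  lookup-delete S x = lookup∘tabulate _

  lookup-deleteClosedNbhd : ∀ S x v →
    lookup (deleteClosedNbhd E S x) v ≡ (lookup S v ∧ not (toℕ v ≡ᵇ toℕ x) ∧ not (E x v))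
  lookup-deleteClosedNbhd S x = lookup∘tabulate _

  deleteClosedNbhd⊆delete : ∀ S x → deleteClosedNbhd E S x ⊆ delete E S x
  deleteClosedNbhd⊆delete S x {v} v∈ = lookup⇒[]= v _
    (trans (lookup-delete S x v) (lemma (lookup S v) _ _ (trans (sym (lookup-deleteClosedNbhd S x v)) ([]=⇒lookup v∈))))
    where
    lemma : ∀ a b c → (a ∧ b ∧ c) ≡ true → (a ∧ b) ≡ true
    lemma true true _ _ = refl

  delete⊂ : ∀ S x → x ∈ S → ∣ delete E S x ∣ < ∣ S ∣
  delete⊂ S x x∈S = p⊂q⇒∣p∣<∣q∣ (⊆ , x , x∈S , x∉)
    where
    ⊆ : delete E S x ⊆ S
    ⊆ {v} v∈ = lookup⇒[]= v S (∧-true⁻ˡ (trans (sym (lookup-delete S x v)) ([]=⇒lookup v∈)))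
    x∉ : x ∉ delete E S x
    x∉ x∈ = true≢false (trans (sym (lookup-delete S x x)) ([]=⇒lookup x∈))
                       (trans (cong (λ b → lookup S x ∧ not b) (≡ᵇ-refl (toℕ x))) (∧-zeroʳ (lookup S x)))

  Dominated : Subset N → Fin N → Set
  Dominated I v = ∃ λ u → u ∈ I × E u v ≡ true

  module _ (E-sym : ∀ u v → E u v ≡ E v u) (E-irrefl : ∀ v → E v v ≡ false) where

    maximal⇒dominating : ∀ {S I v} → MaximalIndependent E S I → v ∈ S → v ∉ I → Dominated I v
    maximal⇒dominating {S} {I} {v} ((I⊆S , I-ind) , I-max) v∈S v∉I
      with any? (λ u → (u ∈? I) ×-dec (E u v ≟ᴮ true))
    ... | yes dom = dom
    ... | no ¬dom = ⊥-elim (v∉I (I-max J (J⊆S , J-ind) (p⊆p∪q ⁅ v ⁆) (q⊆p∪q I ⁅ v ⁆ (x∈⁅x⁆ v))))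
      where
      J : Subset N
      J = I ∪ ⁅ v ⁆
      cases : ∀ {w} → w ∈ J → w ∈ I ⊎ w ≡ v
      cases {w} w∈J with x∈p∪q⁻ I ⁅ v ⁆ w∈J
      ... | inj₁ w∈I = inj₁ w∈I
      ... | inj₂ w∈v = inj₂ (x∈⁅y⁆⇒x≡y v w∈v)
      J⊆S : J ⊆ S
      J⊆S w∈J with cases w∈J
      ... | inj₁ w∈I = I⊆S w∈I
      ... | inj₂ refl = v∈S
      not-dom : ∀ {u} → u ∈ I → E u v ≡ false
      not-dom u∈I = ≢true⇒≡false λ e → ¬dom (_ , u∈I , e)
      J-ind : ∀ u w → u ∈ J → w ∈ J → E u w ≡ false
      J-ind u w u∈ w∈ with cases u∈ | cases w∈
      ... | inj₁ u∈I | inj₁ w∈I = I-ind u w u∈I w∈I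
      ... | inj₁ u∈I | inj₂ refl = not-dom u∈I
      ... | inj₂ refl | inj₁ w∈I = trans (E-sym v w) (not-dom w∈I)
      ... | inj₂ refl | inj₂ refl = E-irrefl v

  dominating⇒maximal : ∀ {S I} → Independent E S I → (∀ {v} → v ∈ S → v ∉ I → Dominated I v)
                     → MaximalIndependent E S I
  dominating⇒maximal {S} {I} I-indep dom = I-indep , maximal
    where
    maximal : ∀ J → Independent E S J → I ⊆ J → J ⊆ I
    maximal J (J⊆S , J-ind) I⊆J {w} w∈J with w ∈? I
    ... | yes w∈I = w∈I
    ... | no  w∉I with dom (J⊆S w∈J) w∉I
    ...   | u , u∈I , e = ⊥-elim (true≢false e (J-ind u w (I⊆J u∈I) w∈J))

  vertexDecomposable⇒wellCovered : ∀ {S} → VertexDecomposable E S → WellCovered E S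
  vertexDecomposable⇒wellCovered (vd-empty wc _)       = wc
  vertexDecomposable⇒wellCovered (vd-shed wc _ _ _ _) = wc

  EdgelessOrShedsWithin : (Subset N → Set) → Subset N → Set
  EdgelessOrShedsWithin P S = NoEdges E S ⊎ ∃ λ x → x ∈ S × P (delete E S x) × P (deleteClosedNbhd E S x)

  vertexDecomposable-byShedding : (P : Subset N → Set)
    → (∀ {S} → P S → WellCovered E S) → (∀ {S} → P S → EdgelessOrShedsWithin P S)
    → ∀ {S} → P S → VertexDecomposable E S
  vertexDecomposable-byShedding P wc step {S} PS = go ∣ S ∣ ≤-refl PS
    where
    go : ∀ f {S} → ∣ S ∣ ≤ f → P S → VertexDecomposable E S
    go f {S} ∣S∣≤f PS with step PS
    ... | inj₁ noEdges = vd-empty (wc PS) noEdges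
    ... | inj₂ (x , x∈S , P-delete , P-dcn) with f | ≤-trans (delete⊂ S x x∈S) ∣S∣≤f
    ...   | suc f′ | s≤s ∣delete∣≤f′ = vd-shed (wc PS) x x∈S (go f′ ∣delete∣≤f′ P-delete)
            (go f′ (≤-trans (p⊆q⇒∣p∣≤∣q∣ (deleteClosedNbhd⊆delete S x)) ∣delete∣≤f′) P-dcn)

pos : ℕ → Bool → ℕ
pos zero    b = bit b
pos (suc t) b = suc (suc (pos t b))

pos-false : ∀ t → pos t false ≡ 2 * t
pos-false zero    = refl
pos-false (suc t) = trans (cong (λ k → suc (suc k)) (pos-false t)) (sym (*-suc 2 t))

pos-true : ∀ t → pos t true ≡ pos t false + 1
pos-true zero    = refl
pos-true (suc t) = cong (λ k → suc (suc k)) (pos-true t)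

sumBelow-pos : ∀ m g → sumBelow (2 * m) g ≡ sumBelow m (λ t → g (pos t false) + g (pos t true))
sumBelow-pos zero    g = refl
sumBelow-pos (suc m) g = begin
  sumBelow (2 * suc m) g                                   ≡⟨ cong (λ k → sumBelow k g) (*-suc 2 m) ⟩
  g 0 + (g 1 + sumBelow (2 * m) (λ i → g (2 + i)))        ≡⟨ cong (λ k → g 0 + (g 1 + k)) (sumBelow-pos m (λ i → g (2 + i))) ⟩
  g 0 + (g 1 + sumBelow m (λ t → g (2 + pos t false) + g (2 + pos t true)))
                                                           ≡⟨ +-assoc (g 0) (g 1) _ ⟨
  g 0 + g 1 + sumBelow m (λ t → g (2 + pos t false) + g (2 + pos t true))
                                                           ∎
  where open ≡-Reasoning

unpos : ℕ → ℕ × Bool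
unpos zero          = 0 , false
unpos (suc zero)    = 0 , true
unpos (suc (suc p)) = suc (proj₁ (unpos p)) , proj₂ (unpos p)

pos-unpos : ∀ p → pos (proj₁ (unpos p)) (proj₂ (unpos p)) ≡ p
pos-unpos zero          = refl
pos-unpos (suc zero)    = refl
pos-unpos (suc (suc p)) = cong (λ k → suc (suc k)) (pos-unpos p)

unpos-pos : ∀ t b → unpos (pos t b) ≡ (t , b)
unpos-pos zero    false = refl
unpos-pos zero    true  = refl
unpos-pos (suc t) b rewrite unpos-pos t b = refl

pos-≡ᵇ : ∀ t b s c → (pos t b ≡ᵇ pos s c) ≡ ((t ≡ᵇ s) ∧ not (b xor c))
pos-≡ᵇ zero    false zero    false = refl
pos-≡ᵇ zero    false zero    true  = refl
pos-≡ᵇ zero    true  zero    false = refl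
pos-≡ᵇ zero    true  zero    true  = refl
pos-≡ᵇ zero    false (suc s) c     = refl
pos-≡ᵇ zero    true  (suc s) c     = refl
pos-≡ᵇ (suc t) b     zero    false = refl
pos-≡ᵇ (suc t) b     zero    true  = refl
pos-≡ᵇ (suc t) b     (suc s) c     = pos-≡ᵇ t b s c

pos-false≤ : ∀ t b → pos t false ≤ pos t b
pos-false≤ zero    b = z≤n
pos-false≤ (suc t) b = s≤s (s≤s (pos-false≤ t b))

pos-mono : ∀ {t s} b → t ≤ s → pos t b ≤ pos s b
pos-mono {s = s} b z≤n = lemma s
  where
  lemma : ∀ s → bit b ≤ pos s b
  lemma zero    = ≤-refl
  lemma (suc s) = m≤n⇒m≤1+n (m≤n⇒m≤1+n (lemma s))
pos-mono b (s≤s h) = s≤s (s≤s (pos-mono b h))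

pos-< : ∀ {t s} b c → t < s → pos t b < pos s c
pos-< {t} {suc s} b c (s≤s h) = s≤s (≤-trans (pos-mono b h) (lemma s b c))
  where
  lemma : ∀ s b c → pos s b ≤ suc (pos s c)
  lemma zero    false c     = z≤n
  lemma zero    true  false = ≤-refl
  lemma zero    true  true  = s≤s z≤n
  lemma (suc s) b     c     = s≤s (s≤s (lemma s b c))

pos%2 : ∀ t b → pos t b % 2 ≡ bit b
pos%2 zero    false = refl
pos%2 zero    true  = refl
pos%2 (suc t) b = trans (cong (_% 2) (+-comm 2 (pos t b))) (trans ([m+n]%n≡m%n (pos t b) 2) (pos%2 t b))

bit-≡ᵇ : ∀ b c → (bit b ≡ᵇ bit c) ≡ not (b xor c)
bit-≡ᵇ false false = refl
bit-≡ᵇ false true  = refl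
bit-≡ᵇ true  false = refl
bit-≡ᵇ true  true  = refl

pos-<ᵇ : ∀ t b k → (pos t b <ᵇ pos k false) ≡ (t <ᵇ k)
pos-<ᵇ zero    false zero    = refl
pos-<ᵇ zero    true  zero    = refl
pos-<ᵇ zero    false (suc k) = refl
pos-<ᵇ zero    true  (suc k) = refl
pos-<ᵇ (suc t) b     zero    = refl
pos-<ᵇ (suc t) b     (suc k) = pos-<ᵇ t b k

pos-∸ : ∀ t b k → k ≤ t → pos t b ∸ pos k false ≡ pos (t ∸ k) b
pos-∸ t       b zero    _       = refl
pos-∸ (suc t) b (suc k) (s≤s h) = pos-∸ t b k h

blockOf-pos : ∀ ks t b → blockOf ks (pos t b) ≡ blockOf ks (pos t false)
blockOf-pos []       t b = refl
blockOf-pos (k ∷ ks) t b rewrite sym (pos-false k) | pos-<ᵇ t b k | pos-<ᵇ t false k with t <ᵇ k in t<ᵇk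
... | true  = refl
... | false with ≮⇒≥ (λ t<k → subst T t<ᵇk (<⇒<ᵇ t<k))
...   | k≤t rewrite pos-∸ t b k k≤t | pos-∸ t false k k≤t = cong suc (blockOf-pos ks (t ∸ k) b)

blockOf-pos-< : ∀ k ks u → u < k → blockOf (k ∷ ks) (pos u false) ≡ 0
blockOf-pos-< k ks u u<k rewrite sym (pos-false k) | pos-<ᵇ u false k | <ᵇ-true u<k = refl

blockOf-pos-≥ : ∀ k ks u → k ≤ u → blockOf (k ∷ ks) (pos u false) ≡ suc (blockOf ks (pos (u ∸ k) false))
blockOf-pos-≥ k ks u k≤u rewrite sym (pos-false k) | pos-<ᵇ u false k | <ᵇ-false k≤u | pos-∸ u false k k≤u = refl

other : ℕ → ℕ
other zero    = 1
other (suc _) = 0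

other<2 : ∀ t → other t < 2
other<2 zero    = s≤s (s≤s z≤n)
other<2 (suc _) = s≤s z≤n

other≢ : ∀ t → other t ≢ t
other≢ zero    ()
other≢ (suc _) ()

blockPartner : ∀ ks → All (2 ≤_) ks → ∀ t → t < sum ks
             → ∃ λ s → s < sum ks × s ≢ t × blockOf ks (pos s false) ≡ blockOf ks (pos t false)
blockPartner (k ∷ ks) (2≤k ∷ 2≤ks) t t<sum with t <? k
... | yes t<k = other t , <-≤-trans s<k (m≤m+n k (sum ks)) , other≢ t ,
                trans (blockOf-pos-< k ks (other t) s<k) (sym (blockOf-pos-< k ks t t<k))
  where
  s<k : other t < k
  s<k = <-≤-trans (other<2 t) 2≤k
... | no t≮k with blockPartner ks 2≤ks (t ∸ k) (+-cancelˡ-< k _ _ (subst (_< k + sum ks) (sym (m+[n∸m]≡n (≮⇒≥ t≮k))) t<sum))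
...   | s , s<sum , s≢t∸k , same-block = k + s , +-monoʳ-< k s<sum , k+s≢t ,
        trans (blockOf-pos-≥ k ks (k + s) (m≤m+n k s))
              (trans (cong suc (trans (cong (λ u → blockOf ks (pos u false)) (m+n∸m≡n k s)) same-block))
                     (sym (blockOf-pos-≥ k ks t (≮⇒≥ t≮k))))
  where
  k+s≢t : k + s ≢ t
  k+s≢t e = s≢t∸k (trans (sym (m+n∸m≡n k s)) (cong (_∸ k) e))

2≤sum : ∀ ks → 1 ≤ length ks → All (2 ≤_) ks → 2 ≤ sum ks
2≤sum (k ∷ ks) _ (2≤k ∷ _) = ≤-trans 2≤k (m≤m+n k (sum ks))

-- X t b, Y t b and Z t are the vertices x_{2t+b+1}, y_{2t+b+1} and z_{t+1}
-- (b read as 0 or 1); `beyond` is the role of the positions past the last vertex.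
data Role : Set where
  X Y    : ℕ → Bool → Role
  Z      : ℕ → Role
  beyond : Role

module D-Properties (n : ℕ) (ks : List ℕ) where

  N : ℕ
  N = 5 * n

  adj : ℕ → ℕ → Bool
  adj p q = arcD n ks p q ∨ arcD n ks q p

  adj-sym : ∀ p q → adj p q ≡ adj q p
  adj-sym p q = ∨-comm (arcD n ks p q) (arcD n ks q p)

  block : ℕ → ℕ
  block t = blockOf ks (pos t false)

  enc : Role → ℕ
  enc (X t b) = pos t b
  enc (Y t b) = 2 * n + pos t b
  enc (Z t)   = 4 * n + t
  enc beyond  = N

  valid : Role → Set
  valid (X t _) = t < n
  valid (Y t _) = t < n
  valid (Z t)   = t < n
  valid beyond  = ⊥

  role : ℕ → Role
  role i with i <ᵇ 2 * n | i <ᵇ 4 * n | i <ᵇ N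
  ... | true  | _     | _     = X (proj₁ (unpos i)) (proj₂ (unpos i))
  ... | false | true  | _     = Y (proj₁ (unpos (i ∸ 2 * n))) (proj₂ (unpos (i ∸ 2 * n)))
  ... | false | false | true  = Z (i ∸ 4 * n)
  ... | false | false | false = beyond

  infix 7 _~_
  _~_ : Role → Role → Bool
  X t b ~ X s c = (block t ≡ᵇ block s) ∧ (b xor c)
  X t b ~ Y s c = (t ≡ᵇ s) ∧ not (b xor c)
  Y t b ~ X s c = (t ≡ᵇ s) ∧ not (b xor c)
  Y t b ~ Z s   = t ≡ᵇ s
  Z t   ~ Y s c = t ≡ᵇ s
  Z t   ~ Z s   = not (t ≡ᵇ s)
  _     ~ _     = false

  ~-irrefl : ∀ r → (r ~ r) ≡ false
  ~-irrefl (X t b) = cong₂ _∧_ (≡ᵇ-refl (block t)) (xor-same b)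
  ~-irrefl (Y t b) = refl
  ~-irrefl (Z t)   = cong not (≡ᵇ-refl t)
  ~-irrefl beyond  = refl

  4n≡2n+2n : 4 * n ≡ 2 * n + 2 * n
  4n≡2n+2n = *-distribʳ-+ n 2 2

  5n≡4n+n : N ≡ 4 * n + n
  5n≡4n+n = trans (*-distribʳ-+ n 4 1) (cong (4 * n +_) (*-identityˡ n))

  2n≤4n : 2 * n ≤ 4 * n
  2n≤4n = *-monoˡ-≤ n {2} {4} (s≤s (s≤s z≤n))

  pos<2n : ∀ {t} b → t < n → pos t b < 2 * n
  pos<2n {t} b t<n = <-≤-trans (pos-< b false t<n) (≤-reflexive (pos-false n))

  pos<2n⁻ : ∀ t b → pos t b < 2 * n → t < n
  pos<2n⁻ t b h with t <? n
  ... | yes t<n = t<n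
  ... | no  t≮n = ⊥-elim (<⇒≱ h (begin
    2 * n         ≡⟨ pos-false n ⟨
    pos n false   ≤⟨ pos-mono false (≮⇒≥ t≮n) ⟩
    pos t false   ≤⟨ pos-false≤ t b ⟩
    pos t b       ∎))
    where open ≤-Reasoning

  yPos-≥ : ∀ t b → 2 * n ≤ enc (Y t b)
  yPos-≥ t b = m≤m+n (2 * n) _

  yPos-< : ∀ {t} b → t < n → enc (Y t b) < 4 * n
  yPos-< b t<n = <-≤-trans (+-monoʳ-< (2 * n) (pos<2n b t<n)) (≤-reflexive (sym 4n≡2n+2n))

  zPos-≥ : ∀ t → 4 * n ≤ enc (Z t)
  zPos-≥ t = m≤m+n (4 * n) t

  zPos-< : ∀ {t} → t < n → enc (Z t) < N
  zPos-< t<n = <-≤-trans (+-monoʳ-< (4 * n) t<n) (≤-reflexive (sym 5n≡4n+n))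

  enc-< : ∀ r → valid r → enc r < N
  enc-< (X t b) v = <-≤-trans (pos<2n b v) (≤-trans 2n≤4n (≤-trans (m≤m+n (4 * n) n) (≤-reflexive (sym 5n≡4n+n))))
  enc-< (Y t b) v = <-≤-trans (yPos-< b v) (≤-trans (m≤m+n (4 * n) n) (≤-reflexive (sym 5n≡4n+n)))
  enc-< (Z t)   v = zPos-< v

  role-enc : ∀ r → valid r → role (enc r) ≡ r
  role-enc (X t b) v rewrite <ᵇ-true (pos<2n b v) | unpos-pos t b = refl
  role-enc (Y t b) v
    rewrite <ᵇ-false {enc (Y t b)} {2 * n} (yPos-≥ t b) | <ᵇ-true (yPos-< b v)
          | m+n∸m≡n (2 * n) (pos t b) | unpos-pos t b = refl
  role-enc (Z t) v
    rewrite <ᵇ-false {enc (Z t)} {2 * n} (≤-trans 2n≤4n (zPos-≥ t)) | <ᵇ-false {enc (Z t)} {4 * n} (zPos-≥ t)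
          | <ᵇ-true (zPos-< v) | m+n∸m≡n (4 * n) t = refl

  enc-role : ∀ i → i < N → valid (role i) × enc (role i) ≡ i
  enc-role i i<N with i <? 2 * n
  ... | yes i<2n rewrite <ᵇ-true i<2n =
        pos<2n⁻ _ _ (subst (_< 2 * n) (sym (pos-unpos i)) i<2n) , pos-unpos i
  ... | no i≮2n with i <? 4 * n
  ...   | yes i<4n rewrite <ᵇ-false (≮⇒≥ i≮2n) | <ᵇ-true i<4n =
          pos<2n⁻ _ _ (subst (_< 2 * n) (sym (pos-unpos (i ∸ 2 * n)))
            (+-cancelˡ-< (2 * n) _ _ (subst (_< 2 * n + 2 * n) (sym (m+[n∸m]≡n (≮⇒≥ i≮2n))) (subst (i <_) 4n≡2n+2n i<4n))))
          , trans (cong (2 * n +_) (pos-unpos (i ∸ 2 * n))) (m+[n∸m]≡n (≮⇒≥ i≮2n))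
  ...   | no i≮4n rewrite <ᵇ-false (≮⇒≥ i≮2n) | <ᵇ-false (≮⇒≥ i≮4n) | <ᵇ-true i<N =
          +-cancelˡ-< (4 * n) _ _ (subst (_< 4 * n + n) (sym (m+[n∸m]≡n (≮⇒≥ i≮4n))) (subst (i <_) 5n≡4n+n i<N))
          , m+[n∸m]≡n (≮⇒≥ i≮4n)

  arc-XX : ∀ p q → p < 2 * n → q < 2 * n →
           arcD n ks p q ≡ ((blockOf ks p ≡ᵇ blockOf ks q) ∧ not ((p % 2) ≡ᵇ (q % 2)))
  arc-XX p q p<2n q<2n
    rewrite ≤ᵇ'-false {4 * n} {p} (<-≤-trans p<2n 2n≤4n) | <ᵇ-true p<2n | <ᵇ-true q<2n
          | ≡ᵇ-false {q} {2 * n + p} (<⇒≢ (<-≤-trans q<2n (m≤m+n (2 * n) p)))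
          = ∨-identityʳ _

  arc-XY : ∀ p q → p < 2 * n → 2 * n ≤ q → arcD n ks p q ≡ (q ≡ᵇ 2 * n + p)
  arc-XY p q p<2n 2n≤q
    rewrite ≤ᵇ'-false {4 * n} {p} (<-≤-trans p<2n 2n≤4n) | <ᵇ-true p<2n | <ᵇ-false 2n≤q
          = ∨-identityʳ _

  arc-Y : ∀ p q → 2 * n ≤ p → p < 4 * n → arcD n ks p q ≡ false
  arc-Y p q 2n≤p p<4n rewrite ≤ᵇ'-false {4 * n} {p} p<4n | <ᵇ-false 2n≤p = refl

  arc-XZ : ∀ p q → p < 2 * n → 4 * n ≤ q → arcD n ks p q ≡ false
  arc-XZ p q p<2n 4n≤q
    rewrite ≤ᵇ'-false {4 * n} {p} (<-≤-trans p<2n 2n≤4n) | <ᵇ-true p<2n | <ᵇ-false (≤-trans 2n≤4n 4n≤q)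
          | ≡ᵇ-false {q} {2 * n + p}
              (λ e → <⇒≢ (<-≤-trans (+-monoʳ-< (2 * n) p<2n) (≤-trans (≤-reflexive (sym 4n≡2n+2n)) 4n≤q)) (sym e))
          = refl

  private
    firstYOf : ℕ → ℕ
    firstYOf p = 2 * n + 2 * (p ∸ 4 * n)

    firstYOf+1< : ∀ p q → 4 * n ≤ p → p < N → 4 * n ≤ q → firstYOf p + 1 < q
    firstYOf+1< p q 4n≤p p<5n 4n≤q = begin-strict
      firstYOf p + 1          ≡⟨ +-assoc (2 * n) _ 1 ⟩
      2 * n + (2 * d + 1)     <⟨ +-monoʳ-< (2 * n) 2d+1<2n ⟩
      2 * n + 2 * n           ≡⟨ 4n≡2n+2n ⟨
      4 * n                   ≤⟨ 4n≤q ⟩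
      q                       ∎
      where
      open ≤-Reasoning
      d : ℕ
      d = p ∸ 4 * n
      d<n : d < n
      d<n = +-cancelˡ-< (4 * n) _ _ (subst (_< 4 * n + n) (sym (m+[n∸m]≡n 4n≤p)) (subst (p <_) 5n≡4n+n p<5n))
      2d+1<2n : 2 * d + 1 < 2 * n
      2d+1<2n = subst (_≤ 2 * n) (trans (*-suc 2 d) (cong suc (+-comm 1 (2 * d)))) (*-monoʳ-≤ 2 d<n)

    firstYOf< : ∀ p q → 4 * n ≤ p → p < N → 4 * n ≤ q → firstYOf p < q
    firstYOf< p q 4n≤p p<5n 4n≤q = <-trans (m<m+n (firstYOf p) z<s) (firstYOf+1< p q 4n≤p p<5n 4n≤q)

  arc-ZX : ∀ p q → 4 * n ≤ p → p < N → q < 2 * n → arcD n ks p q ≡ false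
  arc-ZX p q 4n≤p p<5n q<2n
    rewrite ≤ᵇ'-true {4 * n} {p} 4n≤p | ≤ᵇ'-false {4 * n} {q} (<-≤-trans q<2n 2n≤4n)
          | <ᵇ-false {p} {2 * n} (≤-trans 2n≤4n 4n≤p) | <ᵇ-true p<5n
          | ≡ᵇ-false {q} {2 * n + 2 * (p ∸ 4 * n)} (<⇒≢ (<-≤-trans q<2n (m≤m+n (2 * n) _)))
          | ≡ᵇ-false {q} {2 * n + 2 * (p ∸ 4 * n) + 1}
              (<⇒≢ (<-≤-trans q<2n (≤-trans (m≤m+n (2 * n) _) (m≤m+n _ 1))))
          = refl

  arc-ZY : ∀ p q → 4 * n ≤ p → p < N → 2 * n ≤ q → q < 4 * n →
           arcD n ks p q ≡ ((q ≡ᵇ 2 * n + 2 * (p ∸ 4 * n)) ∨ (q ≡ᵇ 2 * n + 2 * (p ∸ 4 * n) + 1))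
  arc-ZY p q 4n≤p p<5n 2n≤q q<4n
    rewrite ≤ᵇ'-true {4 * n} {p} 4n≤p | ≤ᵇ'-false {4 * n} {q} q<4n | <ᵇ-false {p} {2 * n} (≤-trans 2n≤4n 4n≤p)
          | <ᵇ-true p<5n = refl

  arc-ZZ : ∀ p q → 4 * n ≤ p → p < N → 4 * n ≤ q → q < N → arcD n ks p q ≡ not (p ≡ᵇ q)
  arc-ZZ p q 4n≤p p<5n 4n≤q q<5n
    rewrite ≤ᵇ'-true {4 * n} {p} 4n≤p | ≤ᵇ'-true {4 * n} {q} 4n≤q | <ᵇ-false {p} {2 * n} (≤-trans 2n≤4n 4n≤p)
          | <ᵇ-true p<5n
          | ≡ᵇ-false {q} {2 * n + 2 * (p ∸ 4 * n)} (λ e → <⇒≢ (firstYOf< p q 4n≤p p<5n 4n≤q) (sym e))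
          | ≡ᵇ-false {q} {2 * n + 2 * (p ∸ 4 * n) + 1} (λ e → <⇒≢ (firstYOf+1< p q 4n≤p p<5n 4n≤q) (sym e))
          = ∨-identityʳ _

  private
    yz-≡ᵇ : ∀ t b s → ((2 * n + pos t b ≡ᵇ 2 * n + 2 * s) ∨ (2 * n + pos t b ≡ᵇ 2 * n + 2 * s + 1)) ≡ (t ≡ᵇ s)
    yz-≡ᵇ t b s
      rewrite sym (pos-false s) | +-assoc (2 * n) (pos s false) 1 | sym (pos-true s)
            | +-≡ᵇ-cancelˡ (2 * n) (pos t b) (pos s false) | +-≡ᵇ-cancelˡ (2 * n) (pos t b) (pos s true)
            | pos-≡ᵇ t b s false | pos-≡ᵇ t b s true with t ≡ᵇ s | b
    ... | true  | true  = refl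
    ... | true  | false = refl
    ... | false | true  = refl
    ... | false | false = refl

    xx-sym : ∀ A B b c → (((A ≡ᵇ B) ∧ not (not (b xor c))) ∨ ((B ≡ᵇ A) ∧ not (not (c xor b))))
                        ≡ ((A ≡ᵇ B) ∧ (b xor c))
    xx-sym A B b c rewrite ≡ᵇ-sym B A | xor-comm c b | not-involutive (b xor c) = ∨-idem _

  adj-enc : ∀ r r′ → valid r → valid r′ → adj (enc r) (enc r′) ≡ (r ~ r′)
  adj-enc (X t b) (X s c) v v′
    rewrite arc-XX (pos t b) (pos s c) (pos<2n b v) (pos<2n c v′) | arc-XX (pos s c) (pos t b) (pos<2n c v′) (pos<2n b v)
          | blockOf-pos ks t b | blockOf-pos ks s c | pos%2 t b | pos%2 s c | bit-≡ᵇ b c | bit-≡ᵇ c b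
          = xx-sym (block t) (block s) b c
  adj-enc (X t b) (Y s c) v v′
    rewrite arc-XY (pos t b) (enc (Y s c)) (pos<2n b v) (yPos-≥ s c) | arc-Y (enc (Y s c)) (pos t b) (yPos-≥ s c) (yPos-< c v′)
          | +-≡ᵇ-cancelˡ (2 * n) (pos s c) (pos t b) | pos-≡ᵇ s c t b | ≡ᵇ-sym s t | xor-comm c b = ∨-identityʳ _
  adj-enc (X t b) (Z s) v v′
    rewrite arc-XZ (pos t b) (enc (Z s)) (pos<2n b v) (zPos-≥ s)
          | arc-ZX (enc (Z s)) (pos t b) (zPos-≥ s) (zPos-< v′) (pos<2n b v) = refl
  adj-enc (Y t b) (X s c) v v′
    rewrite arc-Y (enc (Y t b)) (pos s c) (yPos-≥ t b) (yPos-< b v) | arc-XY (pos s c) (enc (Y t b)) (pos<2n c v′) (yPos-≥ t b)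
          | +-≡ᵇ-cancelˡ (2 * n) (pos t b) (pos s c) | pos-≡ᵇ t b s c = refl
  adj-enc (Y t b) (Y s c) v v′
    rewrite arc-Y (enc (Y t b)) (enc (Y s c)) (yPos-≥ t b) (yPos-< b v)
          | arc-Y (enc (Y s c)) (enc (Y t b)) (yPos-≥ s c) (yPos-< c v′) = refl
  adj-enc (Y t b) (Z s) v v′
    rewrite arc-Y (enc (Y t b)) (enc (Z s)) (yPos-≥ t b) (yPos-< b v)
          | arc-ZY (enc (Z s)) (enc (Y t b)) (zPos-≥ s) (zPos-< v′) (yPos-≥ t b) (yPos-< b v)
          | m+n∸m≡n (4 * n) s = yz-≡ᵇ t b s
  adj-enc (Z t) (X s c) v v′
    rewrite arc-ZX (enc (Z t)) (pos s c) (zPos-≥ t) (zPos-< v) (pos<2n c v′)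
          | arc-XZ (pos s c) (enc (Z t)) (pos<2n c v′) (zPos-≥ t) = refl
  adj-enc (Z t) (Y s c) v v′
    rewrite arc-ZY (enc (Z t)) (enc (Y s c)) (zPos-≥ t) (zPos-< v) (yPos-≥ s c) (yPos-< c v′)
          | arc-Y (enc (Y s c)) (enc (Z t)) (yPos-≥ s c) (yPos-< c v′)
          | m+n∸m≡n (4 * n) t | yz-≡ᵇ s c t | ≡ᵇ-sym s t = ∨-identityʳ _
  adj-enc (Z t) (Z s) v v′
    rewrite arc-ZZ (enc (Z t)) (enc (Z s)) (zPos-≥ t) (zPos-< v) (zPos-≥ s) (zPos-< v′)
          | arc-ZZ (enc (Z s)) (enc (Z t)) (zPos-≥ s) (zPos-< v′) (zPos-≥ t) (zPos-< v)
          | +-≡ᵇ-cancelˡ (4 * n) t s | +-≡ᵇ-cancelˡ (4 * n) s t | ≡ᵇ-sym s t = ∨-idem _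

  adj-role : ∀ i j → i < N → j < N → adj i j ≡ (role i ~ role j)
  adj-role i j i<N j<N with enc-role i i<N | enc-role j j<N
  ... | vi , ei | vj , ej = trans (cong₂ adj (sym ei) (sym ej)) (adj-enc (role i) (role j) vi vj)

  role-valid : ∀ (w : Fin N) → valid (role (toℕ w))
  role-valid w = proj₁ (enc-role (toℕ w) (toℕ<n w))

  enc-role-toℕ : ∀ (w : Fin N) → enc (role (toℕ w)) ≡ toℕ w
  enc-role-toℕ w = proj₂ (enc-role (toℕ w) (toℕ<n w))

  G : Adj N
  G = D n ks

  infix 7 _∋_
  _∋_ : Subset N → Role → Bool
  S ∋ r = S ! enc r

  private
    G-irrefl : ∀ v → G v v ≡ false
    G-irrefl v = trans (adj-role (toℕ v) (toℕ v) (toℕ<n v) (toℕ<n v)) (~-irrefl (role (toℕ v)))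

  vertex : ∀ r → valid r → Fin N
  vertex r v = fromℕ< (enc-< r v)

  vertex≡ : ∀ r (v : valid r) → toℕ (vertex r v) ≡ enc r
  vertex≡ r v = toℕ-fromℕ< (enc-< r v)

  vertex∈ : ∀ {S} r (v : valid r) → S ∋ r ≡ true → vertex r v ∈ S
  vertex∈ {S} r v r∈S = !⇒∈ (trans (cong (S !_) (vertex≡ r v)) r∈S)

  module _ {S I : Subset N} (I-mis : MaximalIndependent G S I) where

    mis-⊆ : ∀ i → I ! i ≡ true → S ! i ≡ true
    mis-⊆ i e = trans (sym (!-fromℕ< S i<N)) (∈⇒! (proj₁ (proj₁ I-mis) (!⇒∈ (trans (!-fromℕ< I i<N) e))))
      where
      i<N : i < N
      i<N = !-true⇒< I i e

    mis-∌ : ∀ i → S ! i ≡ false → I ! i ≡ false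
    mis-∌ i e = ≢true⇒≡false λ i∈I → true≢false (mis-⊆ i i∈I) e

    mis-independent : ∀ r r′ → valid r → valid r′ → (r ~ r′) ≡ true → I ∋ r ≡ true → I ∋ r′ ≡ true → ⊥
    mis-independent r r′ v v′ r~r′ r∈I r′∈I = true≢false
      (trans (adj-enc r r′ v v′) r~r′)
      (subst₂ (λ a b → adj a b ≡ false) (toℕ-fromℕ< (enc-< r v)) (toℕ-fromℕ< (enc-< r′ v′))
        (proj₂ (proj₁ I-mis) (vertex r v) (vertex r′ v′) (!⇒∈ (trans (!-fromℕ< I (enc-< r v)) r∈I))
                                                  (!⇒∈ (trans (!-fromℕ< I (enc-< r′ v′)) r′∈I))))

    mis-dominated : ∀ r → valid r → S ∋ r ≡ true → I ∋ r ≡ false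
                  → ∃ λ r′ → valid r′ × I ∋ r′ ≡ true × (r′ ~ r) ≡ true
    mis-dominated r v r∈S r∉I
      with maximal⇒dominating G adj-sym-Fin G-irrefl I-mis (!⇒∈ (trans (!-fromℕ< S (enc-< r v)) r∈S))
                                (λ r∈I → true≢false (trans (sym (!-fromℕ< I (enc-< r v))) (∈⇒! r∈I)) r∉I)
      where
      adj-sym-Fin : ∀ u w → G u w ≡ G w u
      adj-sym-Fin u w = adj-sym (toℕ u) (toℕ w)
    ... | u , u∈I , u~r with enc-role (toℕ u) (toℕ<n u)
    ...   | vu , eu = role (toℕ u) , vu , trans (cong (I !_) eu) (∈⇒! u∈I) ,
            (begin
              role (toℕ u) ~ r                     ≡⟨ cong (role (toℕ u) ~_) (role-enc r v) ⟨
              role (toℕ u) ~ role (enc r)          ≡⟨ adj-role (toℕ u) (enc r) (toℕ<n u) (enc-< r v) ⟨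
              adj (toℕ u) (enc r)                  ≡⟨ cong (adj (toℕ u)) (toℕ-fromℕ< (enc-< r v)) ⟨
              adj (toℕ u) (toℕ (vertex r v))          ≡⟨ u~r ⟩
              true                                 ∎)
      where open ≡-Reasoning

  gadgetSize : Subset N → ℕ → ℕ
  gadgetSize I t = bit (I ∋ X t false) + bit (I ∋ X t true) + bit (I ∋ Y t false) + bit (I ∋ Y t true) + bit (I ∋ Z t)

  ∣∣≡sumGadgets : ∀ I → ∣ I ∣ ≡ sumBelow n (gadgetSize I)
  ∣∣≡sumGadgets I = begin
    ∣ I ∣                                                       ≡⟨ ∣ I ∣-sumBelow ⟩
    sumBelow N f                                                ≡⟨ cong (λ m → sumBelow m f) 5n≡2n+[2n+n] ⟩
    sumBelow (2 * n + (2 * n + n)) f                            ≡⟨ sumBelow-+ (2 * n) _ f ⟩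
    sumBelow (2 * n) f + sumBelow (2 * n + n) (λ i → f (2 * n + i))
                                   ≡⟨ cong (sumBelow (2 * n) f +_) (sumBelow-+ (2 * n) n (λ i → f (2 * n + i))) ⟩
    sumBelow (2 * n) f + (sumBelow (2 * n) (λ i → f (2 * n + i)) + sumBelow n (λ i → f (2 * n + (2 * n + i))))
                                   ≡⟨ cong₂ (λ a b → a + (b + sumBelow n (λ i → f (2 * n + (2 * n + i)))))
                                            (sumBelow-pos n f) (sumBelow-pos n (λ i → f (2 * n + i))) ⟩
    sumBelow n xs + (sumBelow n ys + sumBelow n (λ i → f (2 * n + (2 * n + i))))
                                   ≡⟨ cong (λ k → sumBelow n xs + (sumBelow n ys + k))
                                           (sumBelow-cong n (λ t _ → cong f 2n+[2n+t]≡4n+t)) ⟩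
    sumBelow n xs + (sumBelow n ys + sumBelow n zs)             ≡⟨ cong (sumBelow n xs +_) (sumBelow-distrib n ys zs) ⟨
    sumBelow n xs + sumBelow n (λ t → ys t + zs t)              ≡⟨ sumBelow-distrib n xs _ ⟨
    sumBelow n (λ t → xs t + (ys t + zs t))                     ≡⟨ sumBelow-cong n (λ t _ → regroup t) ⟩
    sumBelow n (gadgetSize I)                                   ∎
    where
    open ≡-Reasoning
    f : ℕ → ℕ
    f i = bit (I ! i)
    xs ys zs : ℕ → ℕ
    xs t = bit (I ∋ X t false) + bit (I ∋ X t true)
    ys t = bit (I ∋ Y t false) + bit (I ∋ Y t true)
    zs t = bit (I ∋ Z t)
    5n≡2n+[2n+n] : N ≡ 2 * n + (2 * n + n)
    5n≡2n+[2n+n] = trans 5n≡4n+n (trans (cong (_+ n) 4n≡2n+2n) (+-assoc (2 * n) (2 * n) n))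
    2n+[2n+t]≡4n+t : ∀ {t} → 2 * n + (2 * n + t) ≡ 4 * n + t
    2n+[2n+t]≡4n+t {t} = trans (sym (+-assoc (2 * n) (2 * n) t)) (cong (_+ t) (sym 4n≡2n+2n))
    regroup : ∀ t → xs t + (ys t + zs t) ≡ gadgetSize I t
    regroup t = trans (sym (+-assoc (xs t) (ys t) (zs t))) (cong (_+ zs t) (sym (+-assoc (xs t) _ _)))

  wellCovered-byGadgets : ∀ S
    → (∀ {I J} → MaximalIndependent G S I → MaximalIndependent G S J → ∀ t → t < n → gadgetSize I t ≡ gadgetSize J t)
    → WellCovered G S
  wellCovered-byGadgets S sizes I J I-mis J-mis = begin
    ∣ I ∣                         ≡⟨ ∣∣≡sumGadgets I ⟩
    sumBelow n (gadgetSize I)     ≡⟨ sumBelow-cong n (sizes I-mis J-mis) ⟩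
    sumBelow n (gadgetSize J)     ≡⟨ ∣∣≡sumGadgets J ⟨
    ∣ J ∣                         ∎
    where open ≡-Reasoning

  X~X : ∀ t s b → block s ≡ block t → X t b ~ X s (not b) ≡ true
  X~X t s b bs≡bt = cong₂ _∧_ (trans (cong (block t ≡ᵇ_) bs≡bt) (≡ᵇ-refl (block t))) (xor-not b)

  X~Y : ∀ t b → X t b ~ Y t b ≡ true
  X~Y t b = cong₂ _∧_ (≡ᵇ-refl t) (cong not (xor-same b))

  Y~Z : ∀ t b → Y t b ~ Z t ≡ true
  Y~Z t b = ≡ᵇ-refl t

  X~Y⁻ : ∀ t b s c → X t b ~ Y s c ≡ true → X t b ≡ X s c
  X~Y⁻ t b s c t~s = cong₂ X (≡ᵇ-true⁻ (∧-true⁻ˡ t~s)) (not-xor-true⁻ {b} {c} (∧-true⁻ʳ {t ≡ᵇ s} t~s))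

  module _ {S I : Subset N} (I-mis : MaximalIndependent G S I) {t} (t<n : t < n) where

    X-dominated : ∀ b → S ∋ X t b ≡ true → I ∋ X t b ≡ false
                → I ∋ Y t b ≡ true ⊎ ∃ λ s → s < n × block s ≡ block t × I ∋ X s (not b) ≡ true
    X-dominated b x∈S x∉I = byDominator (mis-dominated I-mis (X t b) t<n x∈S x∉I)
      where
      byDominator : (∃ λ r → valid r × I ∋ r ≡ true × r ~ X t b ≡ true)
                  → I ∋ Y t b ≡ true ⊎ ∃ λ s → s < n × block s ≡ block t × I ∋ X s (not b) ≡ true
      byDominator (X s c , s<n , c∈I , s~t) =
        inj₂ (s , s<n , ≡ᵇ-true⁻ (∧-true⁻ˡ s~t) , subst (λ c → I ∋ X s c ≡ true) (xor-true⁻ (∧-true⁻ʳ s~t)) c∈I)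
      byDominator (Y s c , _ , c∈I , s~t)
        rewrite ≡ᵇ-true⁻ {s} {t} (∧-true⁻ˡ s~t) | not-xor-true⁻ {c} {b} (∧-true⁻ʳ s~t) = inj₁ c∈I
      byDominator (Z _ , _ , _ , ())
      byDominator (beyond , () , _)

    Y-dominated : ∀ b → S ∋ Y t b ≡ true → I ∋ Y t b ≡ false → I ∋ X t b ≡ true ⊎ I ∋ Z t ≡ true
    Y-dominated b y∈S y∉I = byDominator (mis-dominated I-mis (Y t b) t<n y∈S y∉I)
      where
      byDominator : (∃ λ r → valid r × I ∋ r ≡ true × r ~ Y t b ≡ true) → I ∋ X t b ≡ true ⊎ I ∋ Z t ≡ true
      byDominator (X s c , _ , c∈I , s~t)
        rewrite ≡ᵇ-true⁻ {s} {t} (∧-true⁻ˡ s~t) | not-xor-true⁻ {c} {b} (∧-true⁻ʳ s~t) = inj₁ c∈I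
      byDominator (Y _ _ , _ , _ , ())
      byDominator (Z s , _ , s∈I , s~t) rewrite ≡ᵇ-true⁻ {s} {t} s~t = inj₂ s∈I
      byDominator (beyond , () , _)

    -- Two x's of one block dominating x_{2t+1} and x_{2t+2} would have opposite
    -- parities, hence be adjacent.
    gadget-meets : S ∋ X t false ≡ true → S ∋ X t true ≡ true
                 → I ∋ X t false ≡ false → I ∋ X t true ≡ false → I ∋ Y t false ≡ false → I ∋ Y t true ≡ false → ⊥
    gadget-meets x₀∈S x₁∈S x₀∉I x₁∉I y₀∉I y₁∉I = both (X-dominated false x₀∈S x₀∉I) (X-dominated true x₁∈S x₁∉I)
      where
      XDominator : Bool → Set
      XDominator b = I ∋ Y t b ≡ true ⊎ ∃ λ s → s < n × block s ≡ block t × I ∋ X s (not b) ≡ true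
      both : XDominator false → XDominator true → ⊥
      both (inj₁ y₀∈I) _          = true≢false y₀∈I y₀∉I
      both (inj₂ _)    (inj₁ y₁∈I) = true≢false y₁∈I y₁∉I
      both (inj₂ (s , s<n , bs , s∈I)) (inj₂ (s′ , s′<n , bs′ , s′∈I)) =
        mis-independent I-mis (X s true) (X s′ false) s<n s′<n (X~X s s′ true (trans bs′ (sym bs))) s∈I s′∈I

  gadgetSize-pairs : ∀ I t → gadgetSize I t
    ≡ (bit (I ∋ X t false) + bit (I ∋ Y t false)) + (bit (I ∋ X t true) + bit (I ∋ Y t true)) + bit (I ∋ Z t)
  gadgetSize-pairs I t = regroup (bit (I ∋ X t false)) (bit (I ∋ X t true)) (bit (I ∋ Y t false)) (bit (I ∋ Y t true)) (bit (I ∋ Z t))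
    where
    regroup : ∀ a b c d e → a + b + c + d + e ≡ (a + c) + (b + d) + e
    regroup = solve 5 (λ a b c d e → a :+ b :+ c :+ d :+ e := (a :+ c) :+ (b :+ d) :+ e) refl

  gadgetSize-noY : ∀ I t → I ∋ Y t false ≡ false → I ∋ Y t true ≡ false
                 → bit (I ∋ X t false) + bit (I ∋ X t true) ≡ 1 → gadgetSize I t ≡ 1 + bit (I ∋ Z t)
  gadgetSize-noY I t y₀∉I y₁∉I one = lemma (I ∋ X t false) (I ∋ X t true) (I ∋ Y t false) (I ∋ Y t true) (I ∋ Z t) y₀∉I y₁∉I one
    where
    lemma : ∀ x₀ x₁ y₀ y₁ z → y₀ ≡ false → y₁ ≡ false → bit x₀ + bit x₁ ≡ 1
          → bit x₀ + bit x₁ + bit y₀ + bit y₁ + bit z ≡ 1 + bit z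
    lemma _ _ _ _ z refl refl one = cong (λ k → k + 0 + 0 + bit z) one

  HasAllXY : Subset N → Set
  HasAllXY S = ∀ t b → t < n → S ∋ X t b ≡ true × S ∋ Y t b ≡ true

  gadgetSize-HasAllXY : ∀ {S I} → HasAllXY S → MaximalIndependent G S I → ∀ t → t < n → gadgetSize I t ≡ 2
  gadgetSize-HasAllXY {S} {I} full I-mis t t<n = byZ (I ∋ Z t) refl
    where
    x≁x : I ∋ X t false ≡ true → I ∋ X t true ≡ true → ⊥
    x≁x = mis-independent I-mis (X t false) (X t true) t<n t<n (X~X t t false refl)
    y∉I : ∀ b → I ∋ Z t ≡ true → I ∋ Y t b ≡ false
    y∉I b z∈I = ≢true⇒≡false λ y∈I → mis-independent I-mis (Y t b) (Z t) t<n t<n (Y~Z t b) y∈I z∈I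
    byZ : ∀ z → I ∋ Z t ≡ z → gadgetSize I t ≡ 2
    byZ true z∈I = begin
      gadgetSize I t                                   ≡⟨ gadgetSize-noY I t (y∉I false z∈I) (y∉I true z∈I) x-pair ⟩
      1 + bit (I ∋ Z t)                                ≡⟨ cong (λ z → 1 + bit z) z∈I ⟩
      2                                                ∎
      where
      open ≡-Reasoning
      x-pair : bit (I ∋ X t false) + bit (I ∋ X t true) ≡ 1
      x-pair = bit+bit≡1 (I ∋ X t false) (I ∋ X t true) x≁x λ x₀∉I x₁∉I →
        gadget-meets I-mis t<n (proj₁ (full t false t<n)) (proj₁ (full t true t<n)) x₀∉I x₁∉I (y∉I false z∈I) (y∉I true z∈I)
    byZ false z∉I = begin
      gadgetSize I t                                   ≡⟨ gadgetSize-pairs I t ⟩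
      pairSize false + pairSize true + bit (I ∋ Z t)   ≡⟨ cong₂ _+_ (cong₂ _+_ (pair false) (pair true)) (cong bit z∉I) ⟩
      2                                                ∎
      where
      open ≡-Reasoning
      pairSize : Bool → ℕ
      pairSize b = bit (I ∋ X t b) + bit (I ∋ Y t b)
      pair : ∀ b → pairSize b ≡ 1
      pair b = bit+bit≡1 (I ∋ X t b) (I ∋ Y t b) (mis-independent I-mis (X t b) (Y t b) t<n t<n (X~Y t b)) λ x∉I y∉I →
        [ (λ x∈I → true≢false x∈I x∉I) , (λ z∈I → true≢false z∈I z∉I) ]′
          (Y-dominated I-mis t<n b (proj₂ (full t b t<n)) y∉I)

  wellCovered-HasAllXY : ∀ S → HasAllXY S → WellCovered G S
  wellCovered-HasAllXY S full = wellCovered-byGadgets S λ I-mis J-mis t t<n →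
    trans (gadgetSize-HasAllXY full I-mis t t<n) (sym (gadgetSize-HasAllXY full J-mis t t<n))

  NoXNeighbour : Subset N → ℕ → Bool → Set
  NoXNeighbour S t b = ∀ s → s < n → block s ≡ block t → S ∋ X s (not b) ≡ false

  Paired : Subset N → ℕ → Bool → Set
  Paired S t b = S ∋ X t (not b) ≡ true × S ∋ Y t (not b) ≡ false
               × (∀ s → s < n → block s ≡ block t → s ≢ t → S ∋ X s (not b) ≡ true → S ∋ Y s (not b) ≡ true)

  -- The vertex sets reached from G \ N[z] by shedding x's.
  Reduced : Subset N → Set
  Reduced S = (∀ t → t < n → S ∋ Z t ≡ false)
            × (∀ t b → t < n → S ∋ X t b ≡ true → S ∋ Y t b ≡ false → NoXNeighbour S t b ⊎ Paired S t b)

  bareXPair : Subset N → ℕ → Bool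
  bareXPair S t = S ∋ X t false ∧ S ∋ X t true ∧ not (S ∋ Y t false) ∧ not (S ∋ Y t true)

  bareXPair-intro : ∀ S t b → S ∋ X t b ≡ true → S ∋ Y t b ≡ false → S ∋ X t (not b) ≡ true → S ∋ Y t (not b) ≡ false
                  → bareXPair S t ≡ true
  bareXPair-intro S t false x₀ y₀ x₁ y₁ = cong₂ _∧_ x₀ (cong₂ _∧_ x₁ (cong₂ _∧_ (cong not y₀) (cong not y₁)))
  bareXPair-intro S t true  x₁ y₁ x₀ y₀ = cong₂ _∧_ x₀ (cong₂ _∧_ x₁ (cong₂ _∧_ (cong not y₀) (cong not y₁)))

  bareXPair-elim : ∀ S t → bareXPair S t ≡ true
                 → S ∋ X t false ≡ true × S ∋ X t true ≡ true × S ∋ Y t false ≡ false × S ∋ Y t true ≡ false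
  bareXPair-elim S t bare = lemma (S ∋ X t false) (S ∋ X t true) (S ∋ Y t false) (S ∋ Y t true) bare
    where
    lemma : ∀ a b c d → (a ∧ b ∧ not c ∧ not d) ≡ true → a ≡ true × b ≡ true × c ≡ false × d ≡ false
    lemma true true false false _ = refl , refl , refl , refl

  module _ {S I : Subset N} (reduced : Reduced S) (I-mis : MaximalIndependent G S I) {t} (t<n : t < n) where

    private
      z∉I : I ∋ Z t ≡ false
      z∉I = mis-∌ I-mis (enc (Z t)) (proj₁ reduced t t<n)

      x∈I : ∀ b → S ∋ X t b ≡ true → S ∋ Y t b ≡ false → NoXNeighbour S t b → I ∋ X t b ≡ true
      x∈I b x∈S y∉S lonely = ≢false⇒≡true {I ∋ X t b} λ x∉I → [
        (λ y∈I → true≢false (mis-⊆ I-mis (enc (Y t b)) y∈I) y∉S) ,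
        (λ { (s , s<n , bs , s∈I) → true≢false (mis-⊆ I-mis (enc (X s (not b))) s∈I) (lonely s s<n bs) }) ]′
        (X-dominated I-mis t<n b x∈S x∉I)

    gadgetSize-bare : bareXPair S t ≡ true → gadgetSize I t ≡ 1
    gadgetSize-bare bare with bareXPair-elim S t bare
    ... | x₀∈S , x₁∈S , y₀∉S , y₁∉S =
      trans (gadgetSize-noY I t y₀∉I y₁∉I
              (bit+bit≡1 (I ∋ X t false) (I ∋ X t true) (mis-independent I-mis (X t false) (X t true) t<n t<n (X~X t t false refl))
                             (λ x₀∉I x₁∉I → gadget-meets I-mis t<n x₀∈S x₁∈S x₀∉I x₁∉I y₀∉I y₁∉I)))
            (cong (λ z → 1 + bit z) z∉I)
      where
      y₀∉I : I ∋ Y t false ≡ false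
      y₀∉I = mis-∌ I-mis (enc (Y t false)) y₀∉S
      y₁∉I : I ∋ Y t true ≡ false
      y₁∉I = mis-∌ I-mis (enc (Y t true)) y₁∉S

    gadgetSize-notBare : bareXPair S t ≡ false
      → gadgetSize I t ≡ bit (S ∋ X t false ∨ S ∋ Y t false) + bit (S ∋ X t true ∨ S ∋ Y t true)
    gadgetSize-notBare notBare = begin
      gadgetSize I t                                                ≡⟨ gadgetSize-pairs I t ⟩
      (bit (I ∋ X t false) + bit (I ∋ Y t false)) + (bit (I ∋ X t true) + bit (I ∋ Y t true)) + bit (I ∋ Z t)
                                                                    ≡⟨ cong₂ _+_ (cong₂ _+_ (pair false) (pair true)) (cong bit z∉I) ⟩
      bit (S ∋ X t false ∨ S ∋ Y t false) + bit (S ∋ X t true ∨ S ∋ Y t true) + 0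
                                                                    ≡⟨ +-identityʳ _ ⟩
      bit (S ∋ X t false ∨ S ∋ Y t false) + bit (S ∋ X t true ∨ S ∋ Y t true) ∎
      where
      open ≡-Reasoning
      pair : ∀ b → bit (I ∋ X t b) + bit (I ∋ Y t b) ≡ bit (S ∋ X t b ∨ S ∋ Y t b)
      pair b = bit+bit≡bit-∨ (S ∋ X t b) (S ∋ Y t b) (I ∋ X t b) (I ∋ Y t b) (mis-⊆ I-mis (enc (X t b))) (mis-⊆ I-mis (enc (Y t b)))
        (mis-independent I-mis (X t b) (Y t b) t<n t<n (X~Y t b))
        (λ y∈S y∉I → [ (λ x∈I → x∈I) , (λ z∈I → ⊥-elim (true≢false z∈I z∉I)) ]′ (Y-dominated I-mis t<n b y∈S y∉I))
        (λ x∈S y∉S → [ x∈I b x∈S y∉S ,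
                       (λ { (x′∈S , y′∉S , _) → ⊥-elim (true≢false (bareXPair-intro S t b x∈S y∉S x′∈S y′∉S) notBare) }) ]′
                     (proj₂ reduced t b t<n x∈S y∉S))

  wellCovered-Reduced : ∀ S → Reduced S → WellCovered G S
  wellCovered-Reduced S reduced = wellCovered-byGadgets S sizes
    where
    sizes : ∀ {I J} → MaximalIndependent G S I → MaximalIndependent G S J → ∀ t → t < n → gadgetSize I t ≡ gadgetSize J t
    sizes I-mis J-mis t t<n with bareXPair S t in bare
    ... | true  = trans (gadgetSize-bare reduced I-mis t<n bare) (sym (gadgetSize-bare reduced J-mis t<n bare))
    ... | false = trans (gadgetSize-notBare reduced I-mis t<n bare) (sym (gadgetSize-notBare reduced J-mis t<n bare))

  enc-injective : ∀ {r r′} → valid r → valid r′ → enc r ≡ enc r′ → r ≡ r′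
  enc-injective {r} {r′} v v′ e = trans (sym (role-enc r v)) (trans (cong role e) (role-enc r′ v′))

  ≟-valid : ∀ {r r′} → valid r → valid r′ → Dec (r ≡ r′)
  ≟-valid {r} {r′} v v′ with enc r ≟ enc r′
  ... | yes e  = yes (enc-injective v v′ e)
  ... | no  ne = no λ e → ne (cong enc e)

  module Shedding (S : Subset N) {x : Fin N} {r₀ : Role} (v₀ : valid r₀) (x≡r₀ : toℕ x ≡ enc r₀) where

    ∋-delete : ∀ r → delete G S x ∋ r ≡ (S ∋ r ∧ not (enc r ≡ᵇ enc r₀))
    ∋-delete r = trans (!-restrict S (λ j → not (j ≡ᵇ toℕ x)) (enc r)) (cong (λ k → S ∋ r ∧ not (enc r ≡ᵇ k)) x≡r₀)

    ∋-deleteClosedNbhd : ∀ r → valid r → deleteClosedNbhd G S x ∋ r ≡ (S ∋ r ∧ not (enc r ≡ᵇ enc r₀) ∧ not (r₀ ~ r))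
    ∋-deleteClosedNbhd r v = trans (!-restrict S (λ j → not (j ≡ᵇ toℕ x) ∧ not (adj (toℕ x) j)) (enc r))
      (cong₂ (λ k a → S ∋ r ∧ not (enc r ≡ᵇ k) ∧ not a) x≡r₀
             (trans (cong (λ k → adj k (enc r)) x≡r₀) (adj-enc r₀ r v₀ v)))

    private
      ≢⇒≡ᵇ-false : ∀ {r} → valid r → r ≢ r₀ → (enc r ≡ᵇ enc r₀) ≡ false
      ≢⇒≡ᵇ-false v r≢r₀ = ≡ᵇ-false λ e → r≢r₀ (enc-injective v v₀ e)

      ∧-not⁺ : ∀ {a b} → a ≡ true → b ≡ false → (a ∧ not b) ≡ true
      ∧-not⁺ refl refl = refl

      ∧-not-not⁺ : ∀ {a b c} → a ≡ true → b ≡ false → c ≡ false → (a ∧ not b ∧ not c) ≡ true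
      ∧-not-not⁺ refl refl refl = refl

      ∧-not-not⁻ : ∀ a b c → (a ∧ not b ∧ not c) ≡ true → b ≡ false × c ≡ false
      ∧-not-not⁻ true false false _ = refl , refl

      ∧-not-not-false⁻ : ∀ a b c → a ≡ true → (a ∧ not b ∧ not c) ≡ false → b ≡ true ⊎ c ≡ true
      ∧-not-not-false⁻ true true  c     _ _ = inj₁ refl
      ∧-not-not-false⁻ true false true  _ _ = inj₂ refl

    delete⁺ : ∀ r → valid r → S ∋ r ≡ true → r ≢ r₀ → delete G S x ∋ r ≡ true
    delete⁺ r v r∈S r≢r₀ = trans (∋-delete r) (∧-not⁺ r∈S (≢⇒≡ᵇ-false v r≢r₀))

    delete⁻ : ∀ r → delete G S x ∋ r ≡ true → S ∋ r ≡ true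
    delete⁻ r r∈ = ∧-true⁻ˡ (trans (sym (∋-delete r)) r∈)

    delete-∌ : ∀ r → S ∋ r ≡ false → delete G S x ∋ r ≡ false
    delete-∌ r r∉S = ≢true⇒≡false λ r∈ → true≢false (delete⁻ r r∈) r∉S

    delete-removes : delete G S x ∋ r₀ ≡ false
    delete-removes = trans (∋-delete r₀) (trans (cong (λ b → S ∋ r₀ ∧ not b) (≡ᵇ-refl (enc r₀))) (∧-zeroʳ _))

    deleteClosedNbhd⁺ : ∀ r → valid r → S ∋ r ≡ true → r ≢ r₀ → r₀ ~ r ≡ false → deleteClosedNbhd G S x ∋ r ≡ true
    deleteClosedNbhd⁺ r v r∈S r≢r₀ r≁r₀ = trans (∋-deleteClosedNbhd r v) (∧-not-not⁺ r∈S (≢⇒≡ᵇ-false v r≢r₀) r≁r₀)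

    deleteClosedNbhd⁻ : ∀ r → valid r → deleteClosedNbhd G S x ∋ r ≡ true → S ∋ r ≡ true × r ≢ r₀ × r₀ ~ r ≡ false
    deleteClosedNbhd⁻ r v r∈ with trans (sym (∋-deleteClosedNbhd r v)) r∈
    ... | r∈′ with ∧-not-not⁻ (S ∋ r) _ _ r∈′
    ...   | r≢ᵇr₀ , r≁r₀ =
      ∧-true⁻ˡ r∈′ , (λ r≡r₀ → true≢false (trans (cong (λ r → enc r ≡ᵇ enc r₀) r≡r₀) (≡ᵇ-refl (enc r₀))) r≢ᵇr₀) , r≁r₀

    deleteClosedNbhd-∌ : ∀ r → valid r → S ∋ r ≡ false → deleteClosedNbhd G S x ∋ r ≡ false
    deleteClosedNbhd-∌ r v r∉S = ≢true⇒≡false λ r∈ → true≢false (proj₁ (deleteClosedNbhd⁻ r v r∈)) r∉S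

    deleteClosedNbhd-removes : ∀ r → valid r → r₀ ~ r ≡ true → deleteClosedNbhd G S x ∋ r ≡ false
    deleteClosedNbhd-removes r v r~r₀ = ≢true⇒≡false λ r∈ → true≢false r~r₀ (proj₂ (proj₂ (deleteClosedNbhd⁻ r v r∈)))

    deleteClosedNbhd-removed : ∀ r → valid r → S ∋ r ≡ true → deleteClosedNbhd G S x ∋ r ≡ false → r ≡ r₀ ⊎ r₀ ~ r ≡ true
    deleteClosedNbhd-removed r v r∈S r∉ with ∧-not-not-false⁻ (S ∋ r) _ _ r∈S (trans (sym (∋-deleteClosedNbhd r v)) r∉)
    ... | inj₁ r≡ᵇr₀ = inj₁ (enc-injective v v₀ (≡ᵇ-true⁻ r≡ᵇr₀))
    ... | inj₂ r~r₀  = inj₂ r~r₀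

  NoXYPair : Subset N → Set
  NoXYPair S = ∀ t b → t < n → S ∋ X t b ≡ true → S ∋ Y t b ≡ false

  reduced-delete : ∀ {S x q e} → q < n → toℕ x ≡ enc (X q e) → Reduced S → S ∋ Y q e ≡ true ⊎ NoXYPair S
                 → Reduced (delete G S x)
  reduced-delete {S} {x} {q} {e} q<n x≡x₀ (noZ , lonelyOrPaired) hyp = (λ t t<n → delete-∌ (Z t) (noZ t t<n)) , lonelyOrPaired′
    where
    open Shedding S {r₀ = X q e} q<n x≡x₀
    S′ : Subset N
    S′ = delete G S x
    lonelyOrPaired′ : ∀ t b → t < n → S′ ∋ X t b ≡ true → S′ ∋ Y t b ≡ false → NoXNeighbour S′ t b ⊎ Paired S′ t b
    lonelyOrPaired′ t b t<n x∈S′ y∉S′ = fromS (lonelyOrPaired t b t<n (delete⁻ (X t b) x∈S′) y∉S)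
      where
      y∉S : S ∋ Y t b ≡ false
      y∉S = ≢true⇒≡false λ y∈S → true≢false (delete⁺ (Y t b) t<n y∈S λ ()) y∉S′
      fromS : NoXNeighbour S t b ⊎ Paired S t b → NoXNeighbour S′ t b ⊎ Paired S′ t b
      fromS (inj₁ lonely) = inj₁ λ s s<n bs → delete-∌ (X s (not b)) (lonely s s<n bs)
      fromS (inj₂ (x′∈S , y′∉S , others)) with ≟-valid {X t (not b)} {X q e} t<n q<n
      ... | no x′≢x₀ = inj₂ (delete⁺ (X t (not b)) t<n x′∈S x′≢x₀ , delete-∌ (Y t (not b)) y′∉S ,
                             λ s s<n bs s≢t xs∈S′ → delete⁺ (Y s (not b)) s<n (others s s<n bs s≢t (delete⁻ (X s (not b)) xs∈S′)) λ ())
      ... | yes x′≡x₀ = [ (λ y₀∈S → ⊥-elim (true≢false (trans (cong (λ k → S ! (2 * n + k)) (cong enc x′≡x₀)) y₀∈S) y′∉S)) ,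
                          (λ noXY → inj₁ (lonely noXY)) ]′ hyp
        where
        -- X t (not b) was the shed vertex, and its block-mates keep their y's.
        lonely : NoXYPair S → NoXNeighbour S′ t b
        lonely noXY s s<n bs with s ≟ t
        ... | yes refl = subst (λ r → S′ ∋ r ≡ false) (sym x′≡x₀) delete-removes
        ... | no  s≢t  = ≢true⇒≡false λ xs∈S′ →
              true≢false (others s s<n bs s≢t (delete⁻ (X s (not b)) xs∈S′)) (noXY s (not b) s<n (delete⁻ (X s (not b)) xs∈S′))

  reduced-deleteClosedNbhd : ∀ {S x q e} → q < n → toℕ x ≡ enc (X q e) → Reduced S → Reduced (deleteClosedNbhd G S x)
  reduced-deleteClosedNbhd {S} {x} {q} {e} q<n x≡x₀ (noZ , lonelyOrPaired) =
    (λ t t<n → deleteClosedNbhd-∌ (Z t) t<n (noZ t t<n)) , lonelyOrPaired″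
    where
    open Shedding S {r₀ = X q e} q<n x≡x₀
    S″ : Subset N
    S″ = deleteClosedNbhd G S x
    lonelyOrPaired″ : ∀ t b → t < n → S″ ∋ X t b ≡ true → S″ ∋ Y t b ≡ false → NoXNeighbour S″ t b ⊎ Paired S″ t b
    lonelyOrPaired″ t b t<n x∈S″ y∉S″ = fromS (lonelyOrPaired t b t<n x∈S y∉S)
      where
      x∈S : S ∋ X t b ≡ true
      x∈S = proj₁ (deleteClosedNbhd⁻ (X t b) t<n x∈S″)
      x≢x₀ : X t b ≢ X q e
      x≢x₀ = proj₁ (proj₂ (deleteClosedNbhd⁻ (X t b) t<n x∈S″))
      x≁x₀ : X q e ~ X t b ≡ false
      x≁x₀ = proj₂ (proj₂ (deleteClosedNbhd⁻ (X t b) t<n x∈S″))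
      y∉S : S ∋ Y t b ≡ false
      y∉S = ≢true⇒≡false λ y∈S → [ (λ ()) , (λ x₀~y → x≢x₀ (sym (X~Y⁻ q e t b x₀~y))) ]′
              (deleteClosedNbhd-removed (Y t b) t<n y∈S y∉S″)
      fromS : NoXNeighbour S t b ⊎ Paired S t b → NoXNeighbour S″ t b ⊎ Paired S″ t b
      fromS (inj₁ lonely) = inj₁ λ s s<n bs → deleteClosedNbhd-∌ (X s (not b)) s<n (lonely s s<n bs)
      fromS (inj₂ (x′∈S , y′∉S , others)) = byPartner (S″ ∋ X t (not b)) refl
        where
        byPartner : ∀ β → S″ ∋ X t (not b) ≡ β → NoXNeighbour S″ t b ⊎ Paired S″ t b
        byPartner true x′∈S″ = inj₂ (x′∈S″ , deleteClosedNbhd-∌ (Y t (not b)) t<n y′∉S , others″)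
          where
          others″ : ∀ s → s < n → block s ≡ block t → s ≢ t → S″ ∋ X s (not b) ≡ true → S″ ∋ Y s (not b) ≡ true
          others″ s s<n bs s≢t xs∈S″ with deleteClosedNbhd⁻ (X s (not b)) s<n xs∈S″
          ... | xs∈S , xs≢x₀ , _ = deleteClosedNbhd⁺ (Y s (not b)) s<n (others s s<n bs s≢t xs∈S) (λ ())
                (≢true⇒≡false λ x₀~ys → xs≢x₀ (sym (X~Y⁻ q e s (not b) x₀~ys)))
        byPartner false x′∉S″ with deleteClosedNbhd-removed (X t (not b)) t<n x′∈S x′∉S″
        ... | inj₁ x′≡x₀ = ⊥-elim (true≢false (subst (λ r → r ~ X t b ≡ true) x′≡x₀ x′~x) x≁x₀)
          where
          x′~x : X t (not b) ~ X t b ≡ true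
          x′~x = subst (λ c → X t (not b) ~ X t c ≡ true) (not-involutive b) (X~X t t (not b) refl)
        ... | inj₂ x₀~x′ = inj₁ λ s s<n bs → deleteClosedNbhd-removes (X s (not b)) s<n
                (trans (cong (λ k → (block q ≡ᵇ k) ∧ (e xor not b)) bs) x₀~x′)

  hasAllXY-delete : ∀ {S x q} → q < n → toℕ x ≡ enc (Z q) → HasAllXY S → HasAllXY (delete G S x)
  hasAllXY-delete {S} {q = q} q<n x≡z₀ full t b t<n =
    delete⁺ (X t b) t<n (proj₁ (full t b t<n)) (λ ()) , delete⁺ (Y t b) t<n (proj₂ (full t b t<n)) (λ ())
    where open Shedding S {r₀ = Z q} q<n x≡z₀

  -- Only the y's of the gadget of Z q leave with N[Z q], so only the x's of that
  -- gadget lose their y, and they are Paired.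
  reduced-deleteClosedNbhd-Z : ∀ {S x q} → q < n → toℕ x ≡ enc (Z q) → HasAllXY S → Reduced (deleteClosedNbhd G S x)
  reduced-deleteClosedNbhd-Z {S} {x} {q} q<n x≡z₀ full = noZ″ , lonelyOrPaired″
    where
    open Shedding S {r₀ = Z q} q<n x≡z₀
    S″ : Subset N
    S″ = deleteClosedNbhd G S x
    noZ″ : ∀ s → s < n → S″ ∋ Z s ≡ false
    noZ″ s s<n = ≢true⇒≡false λ z∈S″ → let (_ , z≢z₀ , z≁z₀) = deleteClosedNbhd⁻ (Z s) s<n z∈S″ in
      z≢z₀ (cong Z (sym (≡ᵇ-true⁻ (not-false⁻ z≁z₀))))
    lonelyOrPaired″ : ∀ t b → t < n → S″ ∋ X t b ≡ true → S″ ∋ Y t b ≡ false → NoXNeighbour S″ t b ⊎ Paired S″ t b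
    lonelyOrPaired″ t b t<n _ y∉S″ =
      [ (λ ()) , (λ z₀~y → inj₂ (paired z₀~y)) ]′ (deleteClosedNbhd-removed (Y t b) t<n (proj₂ (full t b t<n)) y∉S″)
      where
      paired : Z q ~ Y t b ≡ true → Paired S″ t b
      paired z₀~y = deleteClosedNbhd⁺ (X t (not b)) t<n (proj₁ (full t (not b) t<n)) (λ ()) refl
                  , deleteClosedNbhd-removes (Y t (not b)) t<n z₀~y
                  , λ s s<n _ s≢t _ → deleteClosedNbhd⁺ (Y s (not b)) s<n (proj₂ (full s (not b) s<n)) (λ ())
                      (≡ᵇ-false λ q≡s → s≢t (trans (sym q≡s) (≡ᵇ-true⁻ {q} {t} z₀~y)))

  ~-sym : ∀ r r′ → valid r → valid r′ → r ~ r′ ≡ r′ ~ r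
  ~-sym r r′ v v′ = trans (sym (adj-enc r r′ v v′)) (trans (adj-sym (enc r) (enc r′)) (adj-enc r′ r v′ v))

  noEdges-Reduced : ∀ {S} → Reduced S → NoXYPair S → (∀ t → t < n → S ∋ X t false ≡ true → S ∋ X t true ≡ false)
                  → NoEdges G S
  noEdges-Reduced {S} (noZ , lonelyOrPaired) noXY noXPair u w u∈S w∈S =
    trans (adj-role (toℕ u) (toℕ w) (toℕ<n u) (toℕ<n w))
          (nonadjacent (role (toℕ u)) (role (toℕ w)) (role-valid u) (role-valid w) (role∈S u u∈S) (role∈S w w∈S))
    where
    role∈S : ∀ u → u ∈ S → S ∋ role (toℕ u) ≡ true
    role∈S u u∈S = trans (cong (S !_) (enc-role-toℕ u)) (∈⇒! u∈S)
    noXPair′ : ∀ t b → t < n → S ∋ X t b ≡ true → S ∋ X t (not b) ≡ false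
    noXPair′ t false t<n x₀∈S = noXPair t t<n x₀∈S
    noXPair′ t true  t<n x₁∈S = ≢true⇒≡false λ x₀∈S → true≢false x₁∈S (noXPair t t<n x₀∈S)
    xy-nonadjacent : ∀ t b s c → t < n → S ∋ X t b ≡ true → S ∋ Y s c ≡ true → X t b ~ Y s c ≡ false
    xy-nonadjacent t b s c t<n x∈S y∈S = ≢true⇒≡false λ x~y →
      true≢false (trans (cong (λ k → S ! (2 * n + k)) (cong enc (X~Y⁻ t b s c x~y))) y∈S) (noXY t b t<n x∈S)
    nonadjacent : ∀ r r′ → valid r → valid r′ → S ∋ r ≡ true → S ∋ r′ ≡ true → r ~ r′ ≡ false
    nonadjacent (X t b) (X s c) t<n s<n x∈S x′∈S = ≢true⇒≡false λ x~x′ →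
      [ (λ lonely → true≢false (subst (λ c → S ∋ X s c ≡ true) (xor-true⁻ (trans (xor-comm c b) (∧-true⁻ʳ x~x′))) x′∈S)
                               (lonely s s<n (sym (≡ᵇ-true⁻ (∧-true⁻ˡ x~x′))))) ,
        (λ paired → true≢false (proj₁ paired) (noXPair′ t b t<n x∈S)) ]′
      (lonelyOrPaired t b t<n x∈S (noXY t b t<n x∈S))
    nonadjacent (X t b) (Y s c) t<n _   x∈S y∈S = xy-nonadjacent t b s c t<n x∈S y∈S
    nonadjacent (Y s c) (X t b) s<n t<n y∈S x∈S = trans (~-sym (Y s c) (X t b) s<n t<n) (xy-nonadjacent t b s c t<n x∈S y∈S)
    nonadjacent (X _ _) (Z _)   _   _   _   _   = refl
    nonadjacent (Y _ _) (Y _ _) _   _   _   _   = refl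
    nonadjacent (Y _ _) (Z s)   _   s<n _   z∈S = ⊥-elim (true≢false z∈S (noZ s s<n))
    nonadjacent (Z t)   _       t<n _   z∈S _   = ⊥-elim (true≢false z∈S (noZ t t<n))

  shed-X : ∀ {S} t b → t < n → Reduced S → S ∋ X t b ≡ true → S ∋ Y t b ≡ true ⊎ NoXYPair S
         → ∃ λ x → x ∈ S × Reduced (delete G S x) × Reduced (deleteClosedNbhd G S x)
  shed-X {S} t b t<n reduced x∈S hyp =
    vertex (X t b) t<n , vertex∈ {S} (X t b) t<n x∈S ,
    reduced-delete {S} t<n (vertex≡ (X t b) t<n) reduced hyp , reduced-deleteClosedNbhd {S} t<n (vertex≡ (X t b) t<n) reduced

  -- Shed an x together with its y if there is one, else an x whose gadget
  -- partner is also present; if neither exists, no edge is left.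
  reduced-step : ∀ {S} → Reduced S
               → EdgelessOrShedsWithin G Reduced S
  reduced-step {S} reduced = byXYPair (xyPair? false) (xyPair? true)
    where
    XYPair : Bool → Set
    XYPair b = (∃ λ t → t < n × (S ∋ X t b ∧ S ∋ Y t b) ≡ true) ⊎ (∀ t → t < n → (S ∋ X t b ∧ S ∋ Y t b) ≡ false)
    xyPair? : ∀ b → XYPair b
    xyPair? b = findBelow n (λ t → S ∋ X t b ∧ S ∋ Y t b)
    withY : ∀ {b} → (∃ λ t → t < n × (S ∋ X t b ∧ S ∋ Y t b) ≡ true)
          → EdgelessOrShedsWithin G Reduced S
    withY {b} (t , t<n , xy∈S) = inj₂ (shed-X {S} t b t<n reduced (∧-true⁻ˡ xy∈S) (inj₁ (∧-true⁻ʳ xy∈S)))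
    withoutY : NoXYPair S → EdgelessOrShedsWithin G Reduced S
    withoutY noXY with findBelow n (λ t → S ∋ X t false ∧ S ∋ X t true)
    ... | inj₁ (t , t<n , xx∈S) = inj₂ (shed-X {S} t false t<n reduced (∧-true⁻ˡ xx∈S) (inj₂ noXY))
    ... | inj₂ noXX = inj₁ (noEdges-Reduced reduced noXY λ t t<n x₀∈S → ∧-false⁻ x₀∈S (noXX t t<n))
    byXYPair : XYPair false → XYPair true
             → EdgelessOrShedsWithin G Reduced S
    byXYPair (inj₁ found) _             = withY found
    byXYPair (inj₂ _)     (inj₁ found)  = withY found
    byXYPair (inj₂ none₀) (inj₂ none₁) = withoutY noXY
      where
      noXY : NoXYPair S
      noXY t false t<n x∈S = ∧-false⁻ x∈S (none₀ t t<n)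
      noXY t true  t<n x∈S = ∧-false⁻ x∈S (none₁ t t<n)

  HasAllXY⊎Reduced : Subset N → Set
  HasAllXY⊎Reduced S = HasAllXY S ⊎ Reduced S

  hasAllXY⊎reduced-step : ∀ {S} → HasAllXY⊎Reduced S → EdgelessOrShedsWithin G HasAllXY⊎Reduced S
  hasAllXY⊎reduced-step (inj₂ reduced) = fromReduced (reduced-step reduced)
    where
    fromReduced : ∀ {S} → EdgelessOrShedsWithin G Reduced S → EdgelessOrShedsWithin G HasAllXY⊎Reduced S
    fromReduced (inj₁ noEdges) = inj₁ noEdges
    fromReduced (inj₂ (x , x∈S , reduced′ , reduced″)) = inj₂ (x , x∈S , inj₂ reduced′ , inj₂ reduced″)
  hasAllXY⊎reduced-step {S} (inj₁ full) with findBelow n (λ q → S ∋ Z q)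
  ... | inj₁ (q , q<n , z∈S) = inj₂ (vertex (Z q) q<n , vertex∈ {S} (Z q) q<n z∈S ,
          inj₁ (hasAllXY-delete {S} q<n (vertex≡ (Z q) q<n) full) , inj₂ (reduced-deleteClosedNbhd-Z {S} q<n (vertex≡ (Z q) q<n) full))
  ... | inj₂ noZ = hasAllXY⊎reduced-step (inj₂ (noZ , λ t b t<n _ y∉S → ⊥-elim (true≢false (proj₂ (full t b t<n)) y∉S)))

  vertexDecomposable : ∀ {S} → HasAllXY⊎Reduced S → VertexDecomposable G S
  vertexDecomposable = vertexDecomposable-byShedding G HasAllXY⊎Reduced wellCovered hasAllXY⊎reduced-step
    where
    wellCovered : ∀ {S} → HasAllXY⊎Reduced S → WellCovered G S
    wellCovered {S} (inj₁ full)    = wellCovered-HasAllXY S full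
    wellCovered {S} (inj₂ reduced) = wellCovered-Reduced S reduced

  wellCovered-∣∣< : ∀ {S I J} → MaximalIndependent G S I → MaximalIndependent G S J
    → (∀ u → u < n → gadgetSize I u ≡ 2) → (∀ u → u < n → gadgetSize J u ≤ 2) → ∀ t → t < n → gadgetSize J t ≤ 1
    → ¬ WellCovered G S
  wellCovered-∣∣< {S} {I} {J} I-mis J-mis I-full J≤2 t t<n J-short wc = <⇒≢ ∣J∣<∣I∣ (sym (wc I J I-mis J-mis))
    where
    ∣J∣<∣I∣ : ∣ J ∣ < ∣ I ∣
    ∣J∣<∣I∣ = begin-strict
      ∣ J ∣                           ≡⟨ ∣∣≡sumGadgets J ⟩
      sumBelow n (gadgetSize J)       <⟨ sumBelow-mono-< n J≤2 t t<n (s≤s J-short) ⟩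
      sumBelow n (λ _ → 2)            ≡⟨ sumBelow-const n 2 (λ _ _ → refl) ⟩
      n * 2                           ≡⟨ sumBelow-const n 2 I-full ⟨
      sumBelow n (gadgetSize I)       ≡⟨ ∣∣≡sumGadgets I ⟨
      ∣ I ∣                           ∎
      where open ≤-Reasoning

  ofRoles : (Role → Bool) → Subset N
  ofRoles h = tabulate (λ w → h (role (toℕ w)))

  ofRoles-∋ : ∀ h r → valid r → ofRoles h ∋ r ≡ h r
  ofRoles-∋ h r v = trans (!-tabulate (λ w → h (role (toℕ w))) (enc-< r v))
                          (cong h (trans (cong role (toℕ-fromℕ< (enc-< r v))) (role-enc r v)))

  gadgetSize-ofRoles : ∀ h t → t < n → gadgetSize (ofRoles h) t
    ≡ bit (h (X t false)) + bit (h (X t true)) + bit (h (Y t false)) + bit (h (Y t true)) + bit (h (Z t))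
  gadgetSize-ofRoles h t t<n =
    cong₂ _+_ (cong₂ _+_ (cong₂ _+_ (cong₂ _+_ (bit-∋ (X t false) t<n) (bit-∋ (X t true) t<n)) (bit-∋ (Y t false) t<n))
                                     (bit-∋ (Y t true) t<n))
              (bit-∋ (Z t) t<n)
    where
    bit-∋ : ∀ r → valid r → bit (ofRoles h ∋ r) ≡ bit (h r)
    bit-∋ r v = cong bit (ofRoles-∋ h r v)

  record IndependentDominating (r₀ : Role) (h : Role → Bool) : Set where
    field
      excludes    : h r₀ ≡ false
      independent : ∀ r r′ → valid r → valid r′ → h r ≡ true → h r′ ≡ true → r ~ r′ ≡ false
      dominating  : ∀ r → valid r → r ≢ r₀ → h r ≡ false → ∃ λ r′ → valid r′ × h r′ ≡ true × r′ ~ r ≡ true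

  ∈ofRoles⁻ : ∀ {h w} → w ∈ ofRoles h → h (role (toℕ w)) ≡ true
  ∈ofRoles⁻ {h} {w} w∈ = trans (sym (lookup∘tabulate (λ w → h (role (toℕ w))) w)) ([]=⇒lookup w∈)

  ∈ofRoles⁺ : ∀ {h w} → h (role (toℕ w)) ≡ true → w ∈ ofRoles h
  ∈ofRoles⁺ {h} {w} e = lookup⇒[]= w _ (trans (lookup∘tabulate (λ w → h (role (toℕ w))) w) e)

  lookup-delete-allV : ∀ v w → lookup (delete G (allV N) v) w ≡ not (toℕ w ≡ᵇ toℕ v)
  lookup-delete-allV v w = trans (lookup-delete G (allV N) v w) (cong (_∧ not (toℕ w ≡ᵇ toℕ v)) (lookup∘tabulate (λ _ → true) w))

  ofRoles-maximal : ∀ {r₀ h} {v : Fin N} → valid r₀ → toℕ v ≡ enc r₀ → IndependentDominating r₀ h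
                  → MaximalIndependent G (delete G (allV N) v) (ofRoles h)
  ofRoles-maximal {r₀} {h} {v} v₀ v≡r₀ h-mis = dominating⇒maximal G (⊆ , independent′) dominating′
    where
    open IndependentDominating h-mis
    ⊆ : ofRoles h ⊆ delete G (allV N) v
    ⊆ {w} w∈ = lookup⇒[]= w _ (trans (lookup-delete-allV v w) (cong not (≡ᵇ-false w≢v)))
      where
      w≢v : toℕ w ≢ toℕ v
      w≢v w≡v = true≢false (trans (cong h (sym (trans (cong role (trans w≡v v≡r₀)) (role-enc r₀ v₀)))) (∈ofRoles⁻ {h} w∈)) excludes
    independent′ : ∀ u w → u ∈ ofRoles h → w ∈ ofRoles h → G u w ≡ false
    independent′ u w u∈ w∈ = trans (adj-role (toℕ u) (toℕ w) (toℕ<n u) (toℕ<n w))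
      (independent _ _ (role-valid u) (role-valid w) (∈ofRoles⁻ {h} u∈) (∈ofRoles⁻ {h} w∈))
    dominating′ : ∀ {w} → w ∈ delete G (allV N) v → w ∉ ofRoles h → Dominated G (ofRoles h) w
    dominating′ {w} w∈ w∉ = byDominator (dominating (role (toℕ w)) (role-valid w) role≢r₀ h-false)
      where
      role≢r₀ : role (toℕ w) ≢ r₀
      role≢r₀ eq = true≢false (trans (sym (lookup-delete-allV v w)) ([]=⇒lookup w∈))
                              (cong not (trans (cong (_≡ᵇ toℕ v) w≡v) (≡ᵇ-refl (toℕ v))))
        where
        w≡v : toℕ w ≡ toℕ v
        w≡v = trans (sym (enc-role-toℕ w)) (trans (cong enc eq) (sym v≡r₀))
      h-false : h (role (toℕ w)) ≡ false
      h-false = ≢true⇒≡false λ e → w∉ (∈ofRoles⁺ {h} e)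
      byDominator : (∃ λ r′ → valid r′ × h r′ ≡ true × r′ ~ role (toℕ w) ≡ true) → Dominated G (ofRoles h) w
      byDominator (r′ , v′ , r′∈ , r′~w) = vertex r′ v′ , ∈ofRoles⁺ {h} (trans (cong h role-r′) r′∈) , edge
        where
        role-r′ : role (toℕ (vertex r′ v′)) ≡ r′
        role-r′ = trans (cong role (vertex≡ r′ v′)) (role-enc r′ v′)
        edge : G (vertex r′ v′) w ≡ true
        edge = trans (adj-role (toℕ (vertex r′ v′)) (toℕ w) (toℕ<n (vertex r′ v′)) (toℕ<n w))
                     (trans (cong (_~ role (toℕ w)) role-r′) r′~w)

  -- `same u c s e` decides X u c ≡ X s e, and is X u c ~ Y s e.
  same : ℕ → Bool → ℕ → Bool → Bool
  same u c s e = (u ≡ᵇ s) ∧ not (c xor e)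

  same-refl : ∀ u c → same u c u c ≡ true
  same-refl u c = cong₂ _∧_ (≡ᵇ-refl u) (cong not (xor-same c))

  same⁻ : ∀ u c s e → same u c s e ≡ true → X u c ≡ X s e
  same⁻ = X~Y⁻

  same-false : ∀ {u c s e} → X u c ≢ X s e → same u c s e ≡ false
  same-false {u} {c} {s} {e} X≢X = ≢true⇒≡false λ eq → X≢X (same⁻ u c s e eq)

  Y~X : ∀ u c → Y u c ~ X u c ≡ true
  Y~X u c = same-refl u c

  allY : Role → Bool
  allY (Y _ _) = true
  allY _       = false

  allY-independentDominating : ∀ t e → IndependentDominating (X t e) allY
  allY-independentDominating t e = record { excludes = refl ; independent = independent ; dominating = dominating }
    where
    independent : ∀ r r′ → valid r → valid r′ → allY r ≡ true → allY r′ ≡ true → r ~ r′ ≡ false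
    independent (Y _ _) (Y _ _) _ _ _ _ = refl
    dominating : ∀ r → valid r → r ≢ X t e → allY r ≡ false → ∃ λ r′ → valid r′ × allY r′ ≡ true × r′ ~ r ≡ true
    dominating (X u c) u<n _ _ = Y u c , u<n , refl , Y~X u c
    dominating (Z u)   u<n _ _ = Y u false , u<n , refl , Y~Z u false

  gadgetSize-allY : ∀ u → u < n → gadgetSize (ofRoles allY) u ≡ 2
  gadgetSize-allY u u<n = gadgetSize-ofRoles allY u u<n

  gadgetSize-ofRoles≡ : ∀ h t → t < n → ∀ {x₀ x₁ y₀ y₁ z}
    → h (X t false) ≡ x₀ → h (X t true) ≡ x₁ → h (Y t false) ≡ y₀ → h (Y t true) ≡ y₁ → h (Z t) ≡ z
    → gadgetSize (ofRoles h) t ≡ bit x₀ + bit x₁ + bit y₀ + bit y₁ + bit z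
  gadgetSize-ofRoles≡ h t t<n refl refl refl refl refl = gadgetSize-ofRoles h t t<n

  X-injective : ∀ {u c s e} → X u c ≡ X s e → u ≡ s × c ≡ e
  X-injective refl = refl , refl

  same-≢ : ∀ {u s} c e → u ≢ s → same u c s e ≡ false
  same-≢ c e u≢s = cong (_∧ not (c xor e)) (≡ᵇ-false u≢s)


  -- For a block-mate s of t; the gadget of t then contributes only z_{t+1}.
  xWitness : ℕ → Bool → ℕ → Role → Bool
  xWitness t e s (X u c) = same u c s e
  xWitness t e s (Y u c) = not (u ≡ᵇ t) ∧ not (same u c s e)
  xWitness t e s (Z u)   = u ≡ᵇ t
  xWitness t e s beyond  = false

  module _ {t s : ℕ} (e : Bool) (t<n : t < n) (s<n : s < n) (s≢t : s ≢ t) (bs≡bt : block s ≡ block t) where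

    private
      h : Role → Bool
      h = xWitness t e s

    xWitness-independentDominating : IndependentDominating (X t e) h
    xWitness-independentDominating = record
      { excludes    = same-false {t} {e} {s} {e} λ eq → s≢t (sym (proj₁ (X-injective eq)))
      ; independent = independent
      ; dominating  = dominating }
      where
      independent : ∀ r r′ → valid r → valid r′ → h r ≡ true → h r′ ≡ true → r ~ r′ ≡ false
      independent (X u c) (X u′ c′) _ _ hr hr′ with X-injective (same⁻ u c s e hr) | X-injective (same⁻ u′ c′ s e hr′)
      ... | refl , refl | refl , refl = ~-irrefl (X s e)
      independent (X u c) (Y u′ c′) _ _ hr hr′ = ≢true⇒≡false λ x~y →
        true≢false (subst (λ r → h r ≡ true) (same⁻ u c u′ c′ x~y) hr) (not-true⁻ (∧-true⁻ʳ {not (u′ ≡ᵇ t)} hr′))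
      independent (Y u c) (X u′ c′) v v′ hr hr′ = trans (~-sym (Y u c) (X u′ c′) v v′) (independent (X u′ c′) (Y u c) v′ v hr′ hr)
      independent (Y u c) (Z u′)    _ _ hr hr′ = ≢true⇒≡false λ y~z →
        true≢false (trans (cong (_≡ᵇ t) (≡ᵇ-true⁻ {u} {u′} y~z)) hr′) (not-true⁻ (∧-true⁻ˡ hr))
      independent (Z u′)  (Y u c)   v v′ hr hr′ = trans (~-sym (Z u′) (Y u c) v v′) (independent (Y u c) (Z u′) v′ v hr′ hr)
      independent (Z u)   (Z u′)    _ _ hr hr′ rewrite ≡ᵇ-true⁻ {u} {t} hr | ≡ᵇ-true⁻ {u′} {t} hr′ = ~-irrefl (Z t)
      independent (X _ _) (Z _)     _ _ _  _   = refl
      independent (Z _)   (X _ _)   _ _ _  _   = refl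
      independent (Y _ _) (Y _ _)   _ _ _  _   = refl
      byXs : ∀ u c → u < n → block u ≡ block s → c ≢ e → ∃ λ r′ → valid r′ × h r′ ≡ true × r′ ~ X u c ≡ true
      byXs u c _ bu c≢e = X s e , s<n , same-refl s e , subst (λ c → X s e ~ X u c ≡ true) (sym (¬-not c≢e)) (X~X s u e bu)
      dominating : ∀ r → valid r → r ≢ X t e → h r ≡ false → ∃ λ r′ → valid r′ × h r′ ≡ true × r′ ~ r ≡ true
      dominating (X u c) u<n r≢ hr with u ≟ t | u ≟ s
      ... | yes refl | _        = byXs u c u<n (sym bs≡bt) λ c≡e → r≢ (cong (X u) c≡e)
      ... | no _     | yes refl = byXs u c u<n refl λ c≡e → true≢false (trans (cong (same u c u) (sym c≡e)) (same-refl u c)) hr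
      ... | no u≢t   | no u≢s   = Y u c , u<n , cong₂ (λ a b → not a ∧ not b) (≡ᵇ-false u≢t) hr , Y~X u c
      dominating (Y u c) u<n _ hr with u ≟ t
      ... | yes refl = Z u , u<n , ≡ᵇ-refl u , ≡ᵇ-refl u
      ... | no u≢t with X-injective (same⁻ u c s e (not-false⁻ (∧-false⁻ (cong not (≡ᵇ-false u≢t)) hr)))
      ...   | refl , refl = X u c , u<n , same-refl u c , X~Y u c
      dominating (Z u) u<n _ hr = Z t , t<n , ≡ᵇ-refl t , cong not (trans (≡ᵇ-sym t u) hr)

    xWitness-gadgetSize-t : gadgetSize (ofRoles h) t ≤ 1
    xWitness-gadgetSize-t = ≤-reflexive (gadgetSize-ofRoles≡ h t t<n (same-≢ false e t≢s) (same-≢ true e t≢s)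
      (cong (λ b → not b ∧ not (same t false s e)) (≡ᵇ-refl t)) (cong (λ b → not b ∧ not (same t true s e)) (≡ᵇ-refl t)) (≡ᵇ-refl t))
      where
      t≢s : t ≢ s
      t≢s t≡s = s≢t (sym t≡s)

    xWitness-gadgetSize : ∀ u → u < n → gadgetSize (ofRoles h) u ≤ 2
    xWitness-gadgetSize u u<n with u ≟ t | u ≟ s
    ... | yes refl | _ = ≤-trans xWitness-gadgetSize-t (s≤s z≤n)
    ... | no u≢t | yes refl = ≤-reflexive (trans (gadgetSize-ofRoles≡ h u u<n refl refl
                                (cong (λ b → not b ∧ not (same u false u e)) (≡ᵇ-false u≢t))
                                (cong (λ b → not b ∧ not (same u true u e)) (≡ᵇ-false u≢t)) (≡ᵇ-false u≢t))
                                (gadget-s e))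
      where
      gadget-s : ∀ e → bit (same u false u e) + bit (same u true u e) + bit (not (same u false u e))
                       + bit (not (same u true u e)) + 0 ≡ 2
      gadget-s e rewrite ≡ᵇ-refl u with e
      ... | true  = refl
      ... | false = refl
    ... | no u≢t | no u≢s = ≤-reflexive (gadgetSize-ofRoles≡ h u u<n (same-≢ false e u≢s) (same-≢ true e u≢s)
          (cong₂ (λ a b → not a ∧ not b) (≡ᵇ-false u≢t) (same-≢ false e u≢s))
          (cong₂ (λ a b → not a ∧ not b) (≡ᵇ-false u≢t) (same-≢ true e u≢s)) (≡ᵇ-false u≢t))

  not-≢ : ∀ e → not e ≢ e
  not-≢ e eq = not-¬ refl (sym eq)

  yWitness₁ : ℕ → Bool → Role → Bool
  yWitness₁ t e (X u c) = same u c t e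
  yWitness₁ t e (Y u c) = not (same u c t e)
  yWitness₁ t e _       = false

  -- For t′ ≠ t; the gadget of t then contributes only X t (not e).
  yWitness₂ : ℕ → Bool → ℕ → Role → Bool
  yWitness₂ t e t′ (X u c) = ((u ≡ᵇ t) ∨ (u ≡ᵇ t′)) ∧ (c xor e)
  yWitness₂ t e t′ (Y u c) = not (u ≡ᵇ t) ∧ not (u ≡ᵇ t′)
  yWitness₂ t e t′ (Z u)   = u ≡ᵇ t′
  yWitness₂ t e t′ beyond  = false

  module _ {t : ℕ} (e : Bool) (t<n : t < n) where

    private
      h : Role → Bool
      h = yWitness₁ t e

    yWitness₁-independentDominating : IndependentDominating (Y t e) h
    yWitness₁-independentDominating = record
      { excludes    = cong not (same-refl t e)
      ; independent = independent
      ; dominating  = dominating }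
      where
      independent : ∀ r r′ → valid r → valid r′ → h r ≡ true → h r′ ≡ true → r ~ r′ ≡ false
      independent (X u c) (X u′ c′) _ _ hr hr′ with X-injective (same⁻ u c t e hr) | X-injective (same⁻ u′ c′ t e hr′)
      ... | refl , refl | refl , refl = ~-irrefl (X t e)
      independent (X u c) (Y u′ c′) _ _ hr hr′ = ≢true⇒≡false λ x~y →
        true≢false (subst (λ r → h r ≡ true) (same⁻ u c u′ c′ x~y) hr) (not-true⁻ hr′)
      independent (Y u c) (X u′ c′) v v′ hr hr′ = trans (~-sym (Y u c) (X u′ c′) v v′) (independent (X u′ c′) (Y u c) v′ v hr′ hr)
      independent (Y _ _) (Y _ _)   _ _ _  _   = refl
      dominating : ∀ r → valid r → r ≢ Y t e → h r ≡ false → ∃ λ r′ → valid r′ × h r′ ≡ true × r′ ~ r ≡ true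
      dominating (X u c) u<n _  hr = Y u c , u<n , cong not hr , Y~X u c
      dominating (Y u c) _   r≢ hr with X-injective (same⁻ u c t e (not-false⁻ hr))
      ... | refl , refl = ⊥-elim (r≢ refl)
      dominating (Z u)   u<n _  _  =
        Y u (not e) , u<n , cong not (same-false {u} {not e} {t} {e} λ eq → not-≢ e (proj₂ (X-injective eq))) , ≡ᵇ-refl u

    yWitness₁-gadgetSize : ∀ u → u < n → gadgetSize (ofRoles h) u ≡ 2
    yWitness₁-gadgetSize u u<n with u ≟ t
    ... | yes refl = trans (gadgetSize-ofRoles h u u<n) (gadget-t e)
      where
      gadget-t : ∀ e → bit (same u false u e) + bit (same u true u e) + bit (not (same u false u e))
                       + bit (not (same u true u e)) + 0 ≡ 2
      gadget-t e rewrite ≡ᵇ-refl u with e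
      ... | true  = refl
      ... | false = refl
    ... | no u≢t = gadgetSize-ofRoles≡ h u u<n (same-≢ false e u≢t) (same-≢ true e u≢t)
                     (cong not (same-≢ false e u≢t)) (cong not (same-≢ true e u≢t)) refl

  module _ {t t′ : ℕ} (e : Bool) (t<n : t < n) (t′<n : t′ < n) (t′≢t : t′ ≢ t) where

    private
      h : Role → Bool
      h = yWitness₂ t e t′

      ∨-false⁻ : ∀ {a b} → (a ∨ b) ≡ false → a ≡ false × b ≡ false
      ∨-false⁻ {false} {false} _ = refl , refl

      ∨-true⁻ : ∀ {a b} → (a ∨ b) ≡ true → a ≡ false → b ≡ false → ⊥
      ∨-true⁻ {false} {false} ()

    yWitness₂-independentDominating : IndependentDominating (Y t e) h
    yWitness₂-independentDominating = record
      { excludes    = cong (λ b → not b ∧ not (t ≡ᵇ t′)) (≡ᵇ-refl t)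
      ; independent = independent
      ; dominating  = dominating }
      where
      independent : ∀ r r′ → valid r → valid r′ → h r ≡ true → h r′ ≡ true → r ~ r′ ≡ false
      independent (X u c) (X u′ c′) _ _ hr hr′ =
        trans (cong (λ k → (block u ≡ᵇ block u′) ∧ k)
                    (trans (cong₂ _xor_ (xor-true⁻ {c} {e} (∧-true⁻ʳ {(u ≡ᵇ t) ∨ (u ≡ᵇ t′)} hr))
                                         (xor-true⁻ {c′} {e} (∧-true⁻ʳ {(u′ ≡ᵇ t) ∨ (u′ ≡ᵇ t′)} hr′)))
                           (xor-same (not e))))
              (∧-zeroʳ (block u ≡ᵇ block u′))
      independent (X u c) (Y u′ c′) _ _ hr hr′ = ≢true⇒≡false λ x~y →
        ∨-true⁻ {u′ ≡ᵇ t} {u′ ≡ᵇ t′}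
          (subst (λ k → ((k ≡ᵇ t) ∨ (k ≡ᵇ t′)) ≡ true) (proj₁ (X-injective (same⁻ u c u′ c′ x~y))) (∧-true⁻ˡ hr))
                (not-true⁻ (∧-true⁻ˡ hr′)) (not-true⁻ (∧-true⁻ʳ {not (u′ ≡ᵇ t)} hr′))
      independent (Y u c) (X u′ c′) v v′ hr hr′ = trans (~-sym (Y u c) (X u′ c′) v v′) (independent (X u′ c′) (Y u c) v′ v hr′ hr)
      independent (Y u c) (Z u′)    _ _ hr hr′ = ≢true⇒≡false λ y~z →
        true≢false (trans (cong (_≡ᵇ t′) (≡ᵇ-true⁻ {u} {u′} y~z)) hr′) (not-true⁻ (∧-true⁻ʳ {not (u ≡ᵇ t)} hr))
      independent (Z u′)  (Y u c)   v v′ hr hr′ = trans (~-sym (Z u′) (Y u c) v v′) (independent (Y u c) (Z u′) v′ v hr′ hr)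
      independent (Z u)   (Z u′)    _ _ hr hr′ rewrite ≡ᵇ-true⁻ {u} {t′} hr | ≡ᵇ-true⁻ {u′} {t′} hr′ = ~-irrefl (Z t′)
      independent (X _ _) (Z _)     _ _ _  _   = refl
      independent (Z _)   (X _ _)   _ _ _  _   = refl
      independent (Y _ _) (Y _ _)   _ _ _  _   = refl
      dominating : ∀ r → valid r → r ≢ Y t e → h r ≡ false → ∃ λ r′ → valid r′ × h r′ ≡ true × r′ ~ r ≡ true
      dominating (X u c) u<n _ hr = byGadget ((u ≡ᵇ t) ∨ (u ≡ᵇ t′)) refl
        where
        byGadget : ∀ β → ((u ≡ᵇ t) ∨ (u ≡ᵇ t′)) ≡ β → ∃ λ r′ → valid r′ × h r′ ≡ true × r′ ~ X u c ≡ true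
        byGadget true  inGadgets = X u (not e) , u<n , cong₂ _∧_ inGadgets (not-xor e) ,
          subst (λ c → X u (not e) ~ X u c ≡ true) (trans (not-involutive e) (sym (xor-false⁻ (∧-false⁻ inGadgets hr))))
                (X~X u u (not e) refl)
        byGadget false outside = Y u c , u<n ,
          cong₂ (λ a b → not a ∧ not b) (proj₁ (∨-false⁻ {u ≡ᵇ t} outside)) (proj₂ (∨-false⁻ {u ≡ᵇ t} outside)) , Y~X u c
      dominating (Y u c) u<n r≢ hr with u ≟ t | u ≟ t′
      ... | yes refl | _ = X u (not e) , u<n , cong₂ _∧_ (cong (_∨ (u ≡ᵇ t′)) (≡ᵇ-refl u)) (not-xor e) ,
                           subst (λ c → X u (not e) ~ Y u c ≡ true) (sym (¬-not λ c≡e → r≢ (cong (Y u) c≡e))) (X~Y u (not e))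
      ... | no u≢t | yes refl = Z u , u<n , ≡ᵇ-refl u , ≡ᵇ-refl u
      ... | no u≢t | no u≢t′ = ⊥-elim (true≢false (cong₂ (λ a b → not a ∧ not b) (≡ᵇ-false u≢t) (≡ᵇ-false u≢t′)) hr)
      dominating (Z u) u<n _ hr = Z t′ , t′<n , ≡ᵇ-refl t′ , cong not (trans (≡ᵇ-sym t′ u) hr)

    yWitness₂-gadgetSize-t : gadgetSize (ofRoles h) t ≤ 1
    yWitness₂-gadgetSize-t = ≤-reflexive (trans
      (gadgetSize-ofRoles≡ h t t<n (cong (λ b → (b ∨ (t ≡ᵇ t′)) ∧ e) (≡ᵇ-refl t)) (cong (λ b → (b ∨ (t ≡ᵇ t′)) ∧ not e) (≡ᵇ-refl t))
        (cong (λ b → not b ∧ not (t ≡ᵇ t′)) (≡ᵇ-refl t)) (cong (λ b → not b ∧ not (t ≡ᵇ t′)) (≡ᵇ-refl t))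
        (≡ᵇ-false λ t≡t′ → t′≢t (sym t≡t′)))
      (gadget-t e))
      where
      gadget-t : ∀ e → bit e + bit (not e) + 0 + 0 + 0 ≡ 1
      gadget-t true  = refl
      gadget-t false = refl

    yWitness₂-gadgetSize : ∀ u → u < n → gadgetSize (ofRoles h) u ≤ 2
    yWitness₂-gadgetSize u u<n with u ≟ t | u ≟ t′
    ... | yes refl | _ = ≤-trans yWitness₂-gadgetSize-t (s≤s z≤n)
    ... | no u≢t | yes refl = ≤-reflexive (trans
      (gadgetSize-ofRoles≡ h u u<n (x-in false) (x-in true)
        (cong₂ (λ a b → not a ∧ not b) (≡ᵇ-false u≢t) (≡ᵇ-refl u)) (cong₂ (λ a b → not a ∧ not b) (≡ᵇ-false u≢t) (≡ᵇ-refl u))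
        (≡ᵇ-refl u))
      (gadget-t′ e))
      where
      x-in : ∀ c → h (X u c) ≡ c xor e
      x-in c = cong₂ (λ a b → (a ∨ b) ∧ (c xor e)) (≡ᵇ-false u≢t) (≡ᵇ-refl u)
      gadget-t′ : ∀ e → bit e + bit (not e) + 0 + 0 + 1 ≡ 2
      gadget-t′ true  = refl
      gadget-t′ false = refl
    ... | no u≢t | no u≢t′ = ≤-reflexive (gadgetSize-ofRoles≡ h u u<n (x-out false) (x-out true)
        (cong₂ (λ a b → not a ∧ not b) (≡ᵇ-false u≢t) (≡ᵇ-false u≢t′)) (cong₂ (λ a b → not a ∧ not b) (≡ᵇ-false u≢t) (≡ᵇ-false u≢t′))
        (≡ᵇ-false u≢t′))
      where
      x-out : ∀ c → h (X u c) ≡ false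
      x-out c = cong₂ (λ a b → (a ∨ b) ∧ (c xor e)) (≡ᵇ-false u≢t) (≡ᵇ-false u≢t′)

  hasAllXY-allV : HasAllXY (allV N)
  hasAllXY-allV t b t<n = !-tabulate (λ _ → true) (enc-< (X t b) t<n) , !-tabulate (λ _ → true) (enc-< (Y t b) t<n)

  Z-shed : ∀ v → InZ {n} v → Shed G (allV N) v
  Z-shed v 4n≤v = lookup⇒[]= v (allV N) (lookup∘tabulate (λ _ → true) v) ,
                  vertexDecomposable (inj₁ (hasAllXY-delete {allV N} q<n v≡z hasAllXY-allV)) ,
                  vertexDecomposable (inj₂ (reduced-deleteClosedNbhd-Z {allV N} q<n v≡z hasAllXY-allV))
    where
    q : ℕ
    q = toℕ v ∸ 4 * n
    v≡z : toℕ v ≡ enc (Z q)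
    v≡z = sym (m+[n∸m]≡n 4n≤v)
    q<n : q < n
    q<n = +-cancelˡ-< (4 * n) _ _ (subst (_< 4 * n + n) v≡z (subst (toℕ v <_) 5n≡4n+n (toℕ<n v)))

  notWellCovered-X : ∀ {t e} {v : Fin N} → All (2 ≤_) ks → sum ks ≡ n → t < n → toℕ v ≡ enc (X t e)
                   → ¬ WellCovered G (delete G (allV N) v)
  notWellCovered-X {t} {e} 2≤ks sum≡n t<n v≡x with blockPartner ks 2≤ks t (subst (t <_) (sym sum≡n) t<n)
  ... | s , s<sum , s≢t , bs≡bt =
        wellCovered-∣∣< (ofRoles-maximal t<n v≡x (allY-independentDominating t e))
                        (ofRoles-maximal t<n v≡x (xWitness-independentDominating e t<n s<n s≢t bs≡bt))
                        gadgetSize-allY (xWitness-gadgetSize e t<n s<n s≢t bs≡bt) t t<n (xWitness-gadgetSize-t e t<n s<n s≢t bs≡bt)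
    where
    s<n : s < n
    s<n = subst (s <_) sum≡n s<sum

  notWellCovered-Y : ∀ {t e} {v : Fin N} → 2 ≤ n → t < n → toℕ v ≡ enc (Y t e) → ¬ WellCovered G (delete G (allV N) v)
  notWellCovered-Y {t} {e} 2≤n t<n v≡y =
    wellCovered-∣∣< (ofRoles-maximal t<n v≡y (yWitness₁-independentDominating e t<n))
                    (ofRoles-maximal t<n v≡y (yWitness₂-independentDominating e t<n t′<n (other≢ t)))
                    (yWitness₁-gadgetSize e t<n) (yWitness₂-gadgetSize e t<n t′<n (other≢ t)) t t<n
                    (yWitness₂-gadgetSize-t e t<n t′<n (other≢ t))
    where
    t′<n : other t < n
    t′<n = <-≤-trans (other<2 t) 2≤n

  shed⇒Z : 1 ≤ length ks → All (2 ≤_) ks → sum ks ≡ n → ∀ v → Shed G (allV N) v → InZ {n} v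
  shed⇒Z 1≤length 2≤ks sum≡n v (_ , vd , _) with 4 * n ≤? toℕ v
  ... | yes 4n≤v = 4n≤v
  ... | no  4n≰v = ⊥-elim (byRole (role (toℕ v)) (enc-role (toℕ v) (toℕ<n v)))
    where
    wc : WellCovered G (delete G (allV N) v)
    wc = vertexDecomposable⇒wellCovered G vd
    byRole : ∀ r → valid r × enc r ≡ toℕ v → ⊥
    byRole (X t e) (t<n , x≡v) = notWellCovered-X 2≤ks sum≡n t<n (sym x≡v) wc
    byRole (Y t e) (t<n , y≡v) = notWellCovered-Y (subst (2 ≤_) sum≡n (2≤sum ks 1≤length 2≤ks)) t<n (sym y≡v) wc
    byRole (Z t)   (_   , z≡v) = 4n≰v (subst (4 * n ≤_) z≡v (zPos-≥ t))

theorem6p3 : (n : ℕ) (ks : List ℕ) → 1 ≤ length ks → All (2 ≤_) ks → sum ks ≡ n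
           → VertexDecomposable (D n ks) (allV (5 * n))
             × (∀ (v : Fin (5 * n)) → (Shed (D n ks) (allV (5 * n)) v → InZ {n} v)
                                              × (InZ {n} v → Shed (D n ks) (allV (5 * n)) v))
theorem6p3 n ks 1≤length 2≤ks sum≡n =
  vertexDecomposable (inj₁ hasAllXY-allV) , λ v → shed⇒Z 1≤length 2≤ks sum≡n v , Z-shed v
  where open D-Properties n ks
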